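{- Let $\Gamma$ be a finite simple graph and $G\le\mathrm{Aut}(\Gamma)$ such that $(\Gamma,G)$ is a reciprocal pair. Then the number of edges of $\Gamma$ equals $t(G)+t^0(G)$, where $t(G)$ is the number of transpositions in $G$ and $t^0(G)$ is the number of transpositions $(i,j)\in G$ for which $\{i,j\}$ is not an edge of $\Gamma$.
   Context: $F_G(x)=\sum_{g\in G}x^{c(g)}$, $c(g)$ the number of cycles of $g$ on vertices. For $g\in\mathrm{Aut}(\Gamma)$, $\Gamma/g$ has the cycles of $g$ as vertices, two (possibly equal, giving a loop) joined if an edge of $\Gamma$ joins vertices in them; $P_{\Gamma/g}$ is its chromatic polynomial ($0$ if there is a loop). $P_{\Gamma,G}(x)=\sum_{g\in G}P_{\Gamma/g}(x)$. $(\Gamma,G)$ is a reciprocal pair if $P_{\Gamma,G}(x)=(-1)^nF_G(-x)$, $n$ the number of vertices. -}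

module Defs where

open import Data.Bool using (Bool; true; false; _∧_; _∨_; not; if_then_else_)
open import Data.Nat as ℕ using (ℕ; zero; suc; _≤ᵇ_; _<ᵇ_)
open import Data.Fin as Fin using (Fin; toℕ)
open import Data.Fin.Properties using () renaming (_≟_ to _≟ᶠ_)
open import Data.Integer as ℤ using (ℤ; +_)
open import Data.List using (List; []; _∷_; map; foldr; length; filterᵇ; allFin; upTo; concatMap)
open import Data.Bool.ListAction using (all; any)
open import Data.List.Relation.Unary.All using (All)
open import Data.List.Relation.Unary.Any using (Any)
open import Data.List.Relation.Unary.AllPairs using (AllPairs)
open import Data.Fin.Permutation using (Permutation′; _⟨$⟩ʳ_; _≈_; id; _∘ₚ_; flip)
open import Relation.Binary.PropositionalEquality using (_≡_)
open import Relation.Nullary using (¬_; does)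
open import Function using (_∘_)

record SimpleGraph (n : ℕ) : Set where
  field
    adj   : Fin n → Fin n → Bool
    sym   : ∀ i j → adj i j ≡ adj j i
    irrefl : ∀ i → adj i i ≡ false
open SimpleGraph public

_==_ : ∀ {n} → Fin n → Fin n → Bool
i == j = does (i ≟ᶠ j)

countFin : ∀ n → (Fin n → Bool) → ℕ
countFin n p = length (filterᵇ p (allFin n))

numEdges : ∀ {n} → SimpleGraph n → ℕ
numEdges {n} Γ =
  length (filterᵇ (λ ij → (toℕ (ij .Data.Product.proj₁) <ᵇ toℕ (ij .Data.Product.proj₂))
                            ∧ adj Γ (ij .Data.Product.proj₁) (ij .Data.Product.proj₂))
                  (concatMap (λ i → map (i Data.Product.,_) (allFin n)) (allFin n)))
  where import Data.Product

IsAut : ∀ {n} → SimpleGraph n → Permutation′ n → Set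
IsAut Γ g = ∀ i j → adj Γ (g ⟨$⟩ʳ i) (g ⟨$⟩ʳ j) ≡ adj Γ i j

_∈ₚ_ : ∀ {n} → Permutation′ n → List (Permutation′ n) → Set
g ∈ₚ G = Any (λ h → h ≈ g) G

record IsAutSubgroup {n} (Γ : SimpleGraph n) (G : List (Permutation′ n)) : Set where
  field
    automorphisms : All (IsAut Γ) G
    distinct      : AllPairs (λ g h → ¬ (g ≈ h)) G
    hasId         : id ∈ₚ G
    closedComp    : All (λ g → All (λ h → (g ∘ₚ h) ∈ₚ G) G) G
    closedInv     : All (λ g → flip g ∈ₚ G) G

iter : ∀ {n} → Permutation′ n → ℕ → Fin n → Fin n
iter g zero    i = i
iter g (suc k) i = g ⟨$⟩ʳ iter g k i

-- the orbit (cycle) of i : { g^k i | k < n }  (cycle lengths are ≤ n)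
orbit : ∀ {n} → Permutation′ n → Fin n → List (Fin n)
orbit {n} g i = map (λ k → iter g k i) (upTo n)

minFin : ∀ {n} → Fin n → Fin n → Fin n
minFin a b = if toℕ a ≤ᵇ toℕ b then a else b

rep : ∀ {n} → Permutation′ n → Fin n → Fin n
rep g i = foldr minFin i (orbit g i)

isRep : ∀ {n} → Permutation′ n → Fin n → Bool
isRep g i = all (λ j → toℕ i ≤ᵇ toℕ j) (orbit g i)

reps : ∀ {n} → Permutation′ n → List (Fin n)
reps {n} g = filterᵇ (isRep g) (allFin n)

-- c(g): number of cycles of g on the vertices (fixed points included)
cycles : ∀ {n} → Permutation′ n → ℕ
cycles g = length (reps g)

-- Graphs possibly with loops, and their chromatic polynomial evaluated
-- at a natural number k (= number of proper k-colourings; 0 if a loop)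

allFuns : ∀ m k → List (Fin m → Fin k)
allFuns zero    k = (λ ()) ∷ []
allFuns (suc m) k =
  concatMap (λ c → map (λ f → λ { Fin.zero → c ; (Fin.suc j) → f j }) (allFuns m k)) (allFin k)

properᵇ : ∀ {m k} → (Fin m → Fin m → Bool) → (Fin m → Fin k) → Bool
properᵇ {m} a f =
  all (λ i → all (λ j → not (a i j) ∨ not (f i == f j)) (allFin m)) (allFin m)

chromEval : ∀ m → (Fin m → Fin m → Bool) → ℕ → ℕ
chromEval m a k = length (filterᵇ (properᵇ a) (allFuns m k))

-- The quotient graph Γ/g: vertices are the cycles of g (indexed by
-- Fin (cycles g) via the list of representatives); two cycles are joined
-- (possibly by a loop) if some edge of Γ joins vertices in them.

lookupL : ∀ {A : Set} (xs : List A) → Fin (length xs) → A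
lookupL (x ∷ xs) Fin.zero    = x
lookupL (x ∷ xs) (Fin.suc j) = lookupL xs j

quotAdj : ∀ {n} → SimpleGraph n → (g : Permutation′ n) →
          Fin (cycles g) → Fin (cycles g) → Bool
quotAdj {n} Γ g a b =
  any (λ u → any (λ v → adj Γ u v ∧ (rep g u == lookupL (reps g) a)
                                    ∧ (rep g v == lookupL (reps g) b))
                 (allFin n))
      (allFin n)

chromQuot : ∀ {n} → SimpleGraph n → Permutation′ n → ℕ → ℕ
chromQuot Γ g k = chromEval (cycles g) (quotAdj Γ g) k

sumℤ : List ℤ → ℤ
sumℤ = foldr ℤ._+_ (+ 0)

orbChrom : ∀ {n} → SimpleGraph n → List (Permutation′ n) → ℕ → ℤ
orbChrom Γ G k = sumℤ (map (λ g → + chromQuot Γ g k) G)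

cycPoly : ∀ {n} → List (Permutation′ n) → ℤ → ℤ
cycPoly G x = sumℤ (map (λ g → x ℤ.^ cycles g) G)

-- (Γ,G) reciprocal: P_{Γ,G}(x) = (-1)^n F_G(-x) as polynomials; both sides
-- are integer polynomials, so this is equality at every k ∈ ℕ.
Reciprocal : ∀ {n} → SimpleGraph n → List (Permutation′ n) → Set
Reciprocal {n} Γ G =
  ∀ (k : ℕ) → orbChrom Γ G k ≡ (ℤ.- (+ 1)) ℤ.^ n ℤ.* cycPoly G (ℤ.- (+ k))

isTranspOf : ∀ {n} → Permutation′ n → Fin n → Fin n → Bool
isTranspOf {n} g i j =
  not (i == j) ∧ ((g ⟨$⟩ʳ i) == j) ∧ ((g ⟨$⟩ʳ j) == i)
  ∧ all (λ l → (l == i) ∨ (l == j) ∨ ((g ⟨$⟩ʳ l) == l)) (allFin n)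

-- number of pairs i < j such that g = (i j) and P holds of {i,j}
-- (1 if g is a transposition (i j) satisfying P, else 0)
transpCount : ∀ {n} → (Fin n → Fin n → Bool) → Permutation′ n → ℕ
transpCount {n} P g =
  length (filterᵇ (λ i → any (λ j → (toℕ i <ᵇ toℕ j) ∧ isTranspOf g i j ∧ P i j) (allFin n))
                  (allFin n))

t : ∀ {n} → List (Permutation′ n) → ℕ
t G = foldr ℕ._+_ 0 (map (transpCount (λ _ _ → true)) G)

t⁰ : ∀ {n} → SimpleGraph n → List (Permutation′ n) → ℕ
t⁰ Γ G = foldr ℕ._+_ 0 (map (transpCount (λ i j → not (adj Γ i j))) G)

-- Evaluate the reciprocity identity at natural numbers k. Lifting colourings along u ↦ (cycle of u)
-- identifies P_{Γ/g}(k) with the proper k-colourings of Γ constant on the cycles of g, and k ^ c(g)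
-- with all colourings constant on the cycles. Expanding in powers of k (N vertices, m edges):
-- for g = 1 the g-term of P_{Γ,G}(k) - (-1)^N F_G(-k) is k^N - m k^(N-1) - k^N + O(k^(N-2));
-- for a transposition (i j) it is [ij not an edge] k^(N-1) + k^(N-1) + O(k^(N-2)); and any other g
-- forces two independent equalities on invariant colourings, so its term is O(k^(N-2)).
-- The sum over G vanishes for every k, so comparing the coefficient of k^(N-1) for k large
-- gives t(G) + t⁰(G) - m = 0.
module Submission where

open import Data.Bool using (Bool; true; false; T; _∧_; _∨_; not)
open import Data.Bool.Properties using (T-∧; T-∨; ∧-identityʳ)
open import Data.Empty using (⊥-elim)
open import Data.Fin using (Fin; zero; suc; toℕ; punchIn; punchOut)
open import Data.Fin.Properties
  using ( toℕ-injective; toℕ<n; pigeonhole; any?; all?; ¬∀⟶∃¬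
        ; punchOut-cong; punchOut-punchIn; punchIn-punchOut; punchInᵢ≢i; punchOut-injective )
  renaming (_≟_ to _≟ᶠ_)
open import Data.List using (List; []; _∷_; map; foldr; length; filterᵇ; allFin; concatMap; tabulate; _++_)
open import Data.List.Properties using (map-tabulate; length-tabulate)
open import Data.List.Membership.Propositional using (_∈_; lose)
open import Data.List.Membership.Propositional.Properties
  using (∈-allFin; ∈-map⁺; ∈-map⁻; ∈-upTo⁺; ∈-filter⁺; ∈-filter⁻)
open import Data.List.Relation.Unary.Unique.Propositional using (Unique)
open import Data.List.Relation.Unary.Unique.Propositional.Properties using (filter⁺; allFin⁺)
open import Data.List.Relation.Unary.AllPairs using (AllPairs; _∷_)
open import Data.List.Relation.Unary.All as All using (All)
open import Data.List.Relation.Unary.All.Properties using (all⁺; all⁻)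
open import Data.List.Relation.Unary.Any as Any using (here; there)
open import Data.List.Relation.Unary.Any.Properties using (any⁺; any⁻)
open import Data.Bool.ListAction using (all; any)
open import Data.Nat as ℕ using (ℕ; zero; suc; _+_; _*_; _^_; _∸_; _≤_; _<_; _≤ᵇ_; _<ᵇ_; z≤n; s≤s)
open import Data.Nat.DivMod using (_%_; _/_; m≡m%n+[m/n]*n; m%n<n)
open import Data.Nat.Properties
open import Data.Product using (∃; _×_; _,_; proj₁; proj₂)
open import Data.Sum using (_⊎_; inj₁; inj₂; [_,_]′)
import Data.Sum
open import Function using (_∘_; case_of_; Equivalence)
open import Relation.Binary.Definitions using (tri<; tri≈; tri>)
open import Data.Vec.Functional using () renaming (_∷_ to _◂_)
open import Relation.Binary.PropositionalEquality
open import Relation.Nullary using (¬_; yes; no; Dec; does)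
open import Relation.Nullary.Decidable using (map′; _⊎-dec_; dec-true; dec-false)
open import Relation.Nullary.Decidable using (T?)
open import Data.Fin.Permutation using (Permutation′; _⟨$⟩ʳ_; _⟨$⟩ˡ_; inverseˡ; _≈_; id)
open import Data.Integer as ℤ using (ℤ; +_; -_; -1ℤ; ∣_∣)
  renaming (_+_ to _+ℤ_; _-_ to _-ℤ_; _*_ to _*ℤ_; _^_ to _^ℤ_)
import Data.Integer.Properties as ℤ
import Data.Integer.Tactic.RingSolver as ℤ-Solver
open import Data.Nat.Tactic.RingSolver using (solve-∀)
open import Defs renaming (sym to adj-sym)

import Algebra.Properties.CommutativeSemigroup as CommutativeSemigroupProperties
module +-CS = CommutativeSemigroupProperties +-commutativeSemigroup
module *-CS = CommutativeSemigroupProperties *-commutativeSemigroup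

private variable
  A B : Set
  n m k : ℕ

T-ext : ∀ {a b} → (T a → T b) → (T b → T a) → a ≡ b
T-ext {false} {false} _ _ = refl
T-ext {false} {true}  _ g = ⊥-elim (g _)
T-ext {true}  {false} f _ = ⊥-elim (f _)
T-ext {true}  {true}  _ _ = refl

==⇒≡ : {i j : Fin n} → T (i == j) → i ≡ j
==⇒≡ {i = i} {j} h with i ≟ᶠ j
... | yes i≡j = i≡j

≡⇒== : {i j : Fin n} → i ≡ j → T (i == j)
≡⇒== {i = i} refl with i ≟ᶠ i
... | yes _  = _
... | no i≢i = i≢i refl

==-sym : ∀ (x y : Fin n) → (x == y) ≡ (y == x)
==-sym x y = T-ext (λ p → ≡⇒== (sym (==⇒≡ {i = x} p))) (λ p → ≡⇒== (sym (==⇒≡ {i = y} p)))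

T-∧⁻ : ∀ {a b} → T (a ∧ b) → T a × T b
T-∧⁻ = Equivalence.to T-∧

T-∧⁺ : ∀ {a b} → T a → T b → T (a ∧ b)
T-∧⁺ p q = Equivalence.from T-∧ (p , q)

T-not⇒¬T : ∀ {a} → T (not a) → ¬ T a
T-not⇒¬T {false} _ ()

¬T⇒T-not : ∀ {a} → ¬ T a → T (not a)
¬T⇒T-not {false} _ = _
¬T⇒T-not {true}  h = h _

nand⁻ : ∀ {x y} → T (not x ∨ not y) → T x → ¬ T y
nand⁻ {true} {true} ()

nand⁺ : ∀ {x y} → (T x → ¬ T y) → T (not x ∨ not y)
nand⁺ {false}        _ = _
nand⁺ {true} {false} _ = _
nand⁺ {true} {true}  h = h _ _

⟦_⟧ : Bool → ℕ
⟦ true ⟧  = 1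
⟦ false ⟧ = 0

⟦∧⟧ : ∀ a b → ⟦ a ∧ b ⟧ ≡ ⟦ a ⟧ * ⟦ b ⟧
⟦∧⟧ true  b = sym (+-identityʳ ⟦ b ⟧)
⟦∧⟧ false b = refl

⟦⟧-mono : ∀ {a b} → (T a → T b) → ⟦ a ⟧ ≤ ⟦ b ⟧
⟦⟧-mono {false}        _ = z≤n
⟦⟧-mono {true} {true}  _ = ≤-refl
⟦⟧-mono {true} {false} f = ⊥-elim (f _)

⟦⟧-false : ∀ {a} → ¬ T a → ⟦ a ⟧ ≡ 0
⟦⟧-false {false} _ = refl
⟦⟧-false {true}  f = ⊥-elim (f _)

⟦⟧-true : ∀ {a} → T a → ⟦ a ⟧ ≡ 1
⟦⟧-true {true} _ = refl

⟦⟧≤1 : ∀ b → ⟦ b ⟧ ≤ 1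
⟦⟧≤1 true  = ≤-refl
⟦⟧≤1 false = z≤n

⟦⟧*⟦⟧≤⟦⟧ : ∀ b → ⟦ b ⟧ * ⟦ b ⟧ ≤ ⟦ b ⟧
⟦⟧*⟦⟧≤⟦⟧ true  = ≤-refl
⟦⟧*⟦⟧≤⟦⟧ false = z≤n

⟦⟧*-cong : ∀ b {x y} → (T b → x ≡ y) → ⟦ b ⟧ * x ≡ ⟦ b ⟧ * y
⟦⟧*-cong true  e = cong (_+ 0) (e _)
⟦⟧*-cong false e = refl

⟦⟧*-mono : ∀ b {x y} → (T b → x ≤ y) → ⟦ b ⟧ * x ≤ ⟦ b ⟧ * y
⟦⟧*-mono true  e = +-monoˡ-≤ 0 (e _)
⟦⟧*-mono false e = z≤n

∑ : List A → (A → ℕ) → ℕ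
∑ []       F = 0
∑ (x ∷ xs) F = F x + ∑ xs F

syntax ∑ xs (λ x → F) = ∑[ x ← xs ] F

∑-cong : ∀ (xs : List A) {F G : A → ℕ} → (∀ x → F x ≡ G x) → ∑ xs F ≡ ∑ xs G
∑-cong []       e = refl
∑-cong (x ∷ xs) e = cong₂ _+_ (e x) (∑-cong xs e)

∑-mono : ∀ (xs : List A) {F G : A → ℕ} → (∀ x → F x ≤ G x) → ∑ xs F ≤ ∑ xs G
∑-mono []       e = z≤n
∑-mono (x ∷ xs) e = +-mono-≤ (e x) (∑-mono xs e)

∑-zero : ∀ (xs : List A) {F : A → ℕ} → (∀ x → F x ≡ 0) → ∑ xs F ≡ 0
∑-zero []       e = refl
∑-zero (x ∷ xs) e = cong₂ _+_ (e x) (∑-zero xs e)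

∑-+ : ∀ (xs : List A) (F G : A → ℕ) → ∑[ x ← xs ] (F x + G x) ≡ ∑ xs F + ∑ xs G
∑-+ []       F G = refl
∑-+ (x ∷ xs) F G = begin
  F x + G x + ∑[ y ← xs ] (F y + G y) ≡⟨ cong (_+_ (F x + G x)) (∑-+ xs F G) ⟩
  F x + G x + (∑ xs F + ∑ xs G)       ≡⟨ +-assoc (F x) (G x) _ ⟩
  F x + (G x + (∑ xs F + ∑ xs G))     ≡⟨ cong (_+_ (F x)) (+-CS.x∙yz≈y∙xz (G x) (∑ xs F) _) ⟩
  F x + (∑ xs F + (G x + ∑ xs G))     ≡⟨ +-assoc (F x) _ _ ⟨
  F x + ∑ xs F + (G x + ∑ xs G)       ∎
  where open ≡-Reasoning

∑-*ˡ : ∀ (xs : List A) c (F : A → ℕ) → ∑[ x ← xs ] (c * F x) ≡ c * ∑ xs F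
∑-*ˡ []       c F = sym (*-zeroʳ c)
∑-*ˡ (x ∷ xs) c F = trans (cong (_+_ (c * F x)) (∑-*ˡ xs c F)) (sym (*-distribˡ-+ c (F x) _))

∑-*ʳ : ∀ (xs : List A) (F : A → ℕ) c → ∑[ x ← xs ] (F x * c) ≡ ∑ xs F * c
∑-*ʳ []       F c = refl
∑-*ʳ (x ∷ xs) F c = trans (cong (_+_ (F x * c)) (∑-*ʳ xs F c)) (sym (*-distribʳ-+ c (F x) _))

∑-const : ∀ (xs : List A) c → ∑[ _ ← xs ] c ≡ length xs * c
∑-const []       c = refl
∑-const (x ∷ xs) c = cong (_+_ c) (∑-const xs c)

∑-++ : ∀ (xs ys : List A) F → ∑ (xs ++ ys) F ≡ ∑ xs F + ∑ ys F
∑-++ []       ys F = refl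
∑-++ (x ∷ xs) ys F = trans (cong (_+_ (F x)) (∑-++ xs ys F)) (sym (+-assoc (F x) _ _))

∑-map : ∀ (f : A → B) (xs : List A) F → ∑ (map f xs) F ≡ ∑ xs (F ∘ f)
∑-map f []       F = refl
∑-map f (x ∷ xs) F = cong (_+_ (F (f x))) (∑-map f xs F)

∑-concatMap : ∀ (f : A → List B) (xs : List A) F → ∑ (concatMap f xs) F ≡ ∑[ x ← xs ] ∑ (f x) F
∑-concatMap f []       F = refl
∑-concatMap f (x ∷ xs) F = trans (∑-++ (f x) _ F) (cong (_+_ (∑ (f x) F)) (∑-concatMap f xs F))

∑-zero-All : ∀ (xs : List A) {F : A → ℕ} → All (λ x → F x ≡ 0) xs → ∑ xs F ≡ 0
∑-zero-All []       All.[]         = refl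
∑-zero-All (x ∷ xs) (Fx≡0 All.∷ z) = cong₂ _+_ Fx≡0 (∑-zero-All xs z)

∑-comm : ∀ (xs : List A) (ys : List B) (F : A → B → ℕ) →
  ∑[ x ← xs ] ∑[ y ← ys ] F x y ≡ ∑[ y ← ys ] ∑[ x ← xs ] F x y
∑-comm []       ys F = sym (∑-zero ys (λ _ → refl))
∑-comm (x ∷ xs) ys F = trans (cong (_+_ (∑ ys (F x))) (∑-comm xs ys F)) (sym (∑-+ ys (F x) _))

∑-term : ∀ {xs : List A} F {x} → x ∈ xs → F x ≤ ∑ xs F
∑-term F (here refl)      = m≤m+n _ _
∑-term {xs = y ∷ _} F (there x∈xs) = ≤-trans (∑-term F x∈xs) (m≤n+m _ (F y))

length-filterᵇ : ∀ (p : A → Bool) xs → length (filterᵇ p xs) ≡ ∑[ x ← xs ] ⟦ p x ⟧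
length-filterᵇ p []       = refl
length-filterᵇ p (x ∷ xs) with p x
... | true  = cong suc (length-filterᵇ p xs)
... | false = length-filterᵇ p xs

foldr-+-map≡∑ : ∀ (xs : List A) F → foldr _+_ 0 (map F xs) ≡ ∑ xs F
foldr-+-map≡∑ []       F = refl
foldr-+-map≡∑ (x ∷ xs) F = cong (_+_ (F x)) (foldr-+-map≡∑ xs F)

∑-allFin-suc : ∀ F → ∑ (allFin (suc n)) F ≡ F zero + ∑[ i ← allFin n ] F (suc i)
∑-allFin-suc {n} F = cong (_+_ (F zero)) (begin
  ∑ (tabulate suc) F           ≡⟨ cong (λ xs → ∑ xs F) (map-tabulate Function.id suc) ⟨
  ∑ (map suc (allFin n)) F     ≡⟨ ∑-map suc (allFin n) F ⟩
  ∑[ i ← allFin n ] F (suc i)  ∎)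
  where open ≡-Reasoning

∑-allFin-== : ∀ (a : Fin n) → ∑[ i ← allFin n ] ⟦ i == a ⟧ ≡ 1
∑-allFin-== {suc n} zero =
  trans (∑-allFin-suc {n} (λ i → ⟦ i == zero ⟧)) (cong suc (∑-zero (allFin n) (λ _ → refl)))
∑-allFin-== {suc n} (suc a) = trans (∑-allFin-suc {n} (λ i → ⟦ i == suc a ⟧)) (∑-allFin-== a)

∑² : ∀ n → (Fin n → Fin n → ℕ) → ℕ
∑² n F = ∑[ i ← allFin n ] ∑[ j ← allFin n ] F i j

∑²-cong : {F G : Fin n → Fin n → ℕ} → (∀ i j → F i j ≡ G i j) → ∑² n F ≡ ∑² n G
∑²-cong {n = n} e = ∑-cong (allFin n) (λ i → ∑-cong (allFin n) (e i))

∑²-mono : {F G : Fin n → Fin n → ℕ} → (∀ i j → F i j ≤ G i j) → ∑² n F ≤ ∑² n G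
∑²-mono {n = n} e = ∑-mono (allFin n) (λ i → ∑-mono (allFin n) (e i))

∑²-+ : ∀ (F G : Fin n → Fin n → ℕ) → ∑² n (λ i j → F i j + G i j) ≡ ∑² n F + ∑² n G
∑²-+ {n = n} F G = trans (∑-cong (allFin n) (λ i → ∑-+ (allFin n) (F i) (G i))) (∑-+ (allFin n) _ _)

∑²-*ˡ : ∀ c (F : Fin n → Fin n → ℕ) → ∑² n (λ i j → c * F i j) ≡ c * ∑² n F
∑²-*ˡ {n = n} c F = trans (∑-cong (allFin n) (λ i → ∑-*ˡ (allFin n) c (F i))) (∑-*ˡ (allFin n) c _)

∑²-*ʳ : ∀ (F : Fin n → Fin n → ℕ) c → ∑² n (λ i j → F i j * c) ≡ ∑² n F * c
∑²-*ʳ {n = n} F c = trans (∑-cong (allFin n) (λ i → ∑-*ʳ (allFin n) (F i) c)) (∑-*ʳ (allFin n) _ c)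

∑²-term : ∀ (F : Fin n → Fin n → ℕ) i j → F i j ≤ ∑² n F
∑²-term {n = n} F i j = ≤-trans (∑-term (F i) (∈-allFin j)) (∑-term (λ i → ∑ (allFin n) (F i)) (∈-allFin i))

∑²-zero : {F : Fin n → Fin n → ℕ} → (∀ i j → F i j ≡ 0) → ∑² n F ≡ 0
∑²-zero {n = n} e = ∑-zero (allFin n) (λ i → ∑-zero (allFin n) (e i))

∑²-== : ∀ (a b : Fin n) → ∑² n (λ i j → ⟦ (i == a) ∧ (j == b) ⟧) ≡ 1
∑²-== {n = n} a b = begin
  ∑² n (λ i j → ⟦ (i == a) ∧ (j == b) ⟧)   ≡⟨ ∑²-cong (λ i j → ⟦∧⟧ (i == a) (j == b)) ⟩
  ∑² n (λ i j → ⟦ i == a ⟧ * ⟦ j == b ⟧)   ≡⟨ ∑-cong (allFin n) (λ i → ∑-*ˡ (allFin n) ⟦ i == a ⟧ _) ⟩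
  ∑[ i ← allFin n ] (⟦ i == a ⟧ * ∑[ j ← allFin n ] ⟦ j == b ⟧)
                                           ≡⟨ ∑-cong (allFin n) (λ i → cong (⟦ i == a ⟧ *_) (∑-allFin-== b)) ⟩
  ∑[ i ← allFin n ] (⟦ i == a ⟧ * 1)       ≡⟨ ∑-cong (allFin n) (λ i → *-identityʳ ⟦ i == a ⟧) ⟩
  ∑[ i ← allFin n ] ⟦ i == a ⟧             ≡⟨ ∑-allFin-== a ⟩
  1                                        ∎
  where open ≡-Reasoning

∑-∑²-comm : ∀ (xs : List A) (F : A → Fin n → Fin n → ℕ) →
  ∑[ x ← xs ] ∑² n (F x) ≡ ∑² n (λ i j → ∑[ x ← xs ] F x i j)
∑-∑²-comm {n = n} xs F = trans (∑-comm xs (allFin n) _) (∑-cong (allFin n) (λ i → ∑-comm xs (allFin n) _))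

all-allFin⁻ : ∀ (p : Fin n → Bool) → T (all p (allFin n)) → ∀ i → T (p i)
all-allFin⁻ p h i = All.lookup (all⁺ p (allFin _) h) (∈-allFin i)

all-allFin⁺ : ∀ (p : Fin n → Bool) → (∀ i → T (p i)) → T (all p (allFin n))
all-allFin⁺ {n} p h = all⁻ p {allFin n} (All.tabulate (λ {i} _ → h i))

any-allFin⁻ : ∀ (p : Fin n → Bool) → T (any p (allFin n)) → ∃ λ i → T (p i)
any-allFin⁻ p h = Any.satisfied (any⁻ p (allFin _) h)

any-allFin⁺ : ∀ (p : Fin n → Bool) i → T (p i) → T (any p (allFin n))
any-allFin⁺ p i h = any⁺ p (lose (∈-allFin i) h)

Colouring : ℕ → ℕ → Set
Colouring m k = Fin m → Fin k

count : ∀ m k → (Colouring m k → Bool) → ℕ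
count m k P = ∑[ f ← allFuns m k ] ⟦ P f ⟧

Extensional : {X : Set} → (Colouring m k → X) → Set
Extensional F = ∀ {f f′} → f ≗ f′ → F f ≡ F f′

∑-allFuns-suc : ∀ (F : Colouring (suc m) k → ℕ) → Extensional F →
  ∑ (allFuns (suc m) k) F ≡ ∑[ c ← allFin k ] ∑[ f ← allFuns m k ] F (c ◂ f)
∑-allFuns-suc {m} {k} F ext = begin
  ∑ (allFuns (suc m) k) F
    ≡⟨ ∑-concatMap _ (allFin k) F ⟩
  ∑[ c ← allFin k ] ∑ (map _ (allFuns m k)) F
    ≡⟨ ∑-cong (allFin k) (λ c → ∑-map _ (allFuns m k) F) ⟩
  ∑[ c ← allFin k ] ∑[ f ← allFuns m k ] F _
    ≡⟨ ∑-cong (allFin k) (λ c → ∑-cong (allFuns m k) (λ f → ext λ { zero → refl ; (suc _) → refl })) ⟩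
  ∑[ c ← allFin k ] ∑[ f ← allFuns m k ] F (c ◂ f) ∎
  where open ≡-Reasoning

count-true : ∀ m k → count m k (λ _ → true) ≡ k ^ m
count-true zero    k = refl
count-true (suc m) k = begin
  ∑[ _ ← allFuns (suc m) k ] 1        ≡⟨ ∑-allFuns-suc {m} {k} (λ _ → 1) (λ _ → refl) ⟩
  ∑[ _ ← allFin k ] ∑[ _ ← allFuns m k ] 1 ≡⟨ ∑-cong (allFin k) (λ _ → count-true m k) ⟩
  ∑[ _ ← allFin k ] (k ^ m)             ≡⟨ ∑-const (allFin k) (k ^ m) ⟩
  length (allFin k) * k ^ m              ≡⟨ cong (_* k ^ m) (length-tabulate {n = k} Function.id) ⟩
  k * k ^ m                              ∎
  where open ≡-Reasoning

opaque
  _≐ᵇ_ : Colouring m k → Colouring m k → Bool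
  h ≐ᵇ u = all (λ i → h i == u i) (allFin _)

  ≐ᵇ⇒≗ : {h u : Colouring m k} → T (h ≐ᵇ u) → h ≗ u
  ≐ᵇ⇒≗ e i = ==⇒≡ (all-allFin⁻ _ e i)

  ≗⇒≐ᵇ : {h u : Colouring m k} → h ≗ u → T (h ≐ᵇ u)
  ≗⇒≐ᵇ e = all-allFin⁺ _ (λ i → ≡⇒== (e i))

≐ᵇ-extˡ : (u : Colouring m k) → Extensional (_≐ᵇ u)
≐ᵇ-extˡ u e = T-ext (λ p → ≗⇒≐ᵇ λ i → trans (sym (e i)) (≐ᵇ⇒≗ p i))
                    (λ p → ≗⇒≐ᵇ λ i → trans (e i) (≐ᵇ⇒≗ p i))

◂-≐ᵇ : ∀ c (f : Colouring m k) u → ((c ◂ f) ≐ᵇ u) ≡ ((c == u zero) ∧ (f ≐ᵇ (u ∘ suc)))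
◂-≐ᵇ c f u = T-ext
  (λ p → let e = ≐ᵇ⇒≗ p in T-∧⁺ (≡⇒== (e zero)) (≗⇒≐ᵇ (e ∘ suc)))
  (λ p → let (c≡ , f≐) = T-∧⁻ p in
         ≗⇒≐ᵇ λ { zero → ==⇒≡ c≡ ; (suc i) → ≐ᵇ⇒≗ f≐ i })

count-≐ᵇ : ∀ m k (u : Colouring m k) → count m k (_≐ᵇ u) ≡ 1
count-≐ᵇ zero    k u = cong (_+ 0) (⟦⟧-true (≗⇒≐ᵇ λ ()))
count-≐ᵇ (suc m) k u = begin
  count (suc m) k (_≐ᵇ u)
    ≡⟨ ∑-allFuns-suc (⟦_⟧ ∘ (_≐ᵇ u)) (cong ⟦_⟧ ∘ ≐ᵇ-extˡ u) ⟩
  ∑[ c ← allFin k ] ∑[ f ← allFuns m k ] ⟦ (c ◂ f) ≐ᵇ u ⟧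
    ≡⟨ ∑-cong (allFin k) (λ c → ∑-cong (allFuns m k) (λ f →
         trans (cong ⟦_⟧ (◂-≐ᵇ c f u)) (⟦∧⟧ (c == u zero) _))) ⟩
  ∑[ c ← allFin k ] ∑[ f ← allFuns m k ] (⟦ c == u zero ⟧ * ⟦ f ≐ᵇ (u ∘ suc) ⟧)
    ≡⟨ ∑-cong (allFin k) (λ c → ∑-*ˡ (allFuns m k) ⟦ c == u zero ⟧ _) ⟩
  ∑[ c ← allFin k ] (⟦ c == u zero ⟧ * count m k (_≐ᵇ (u ∘ suc)))
    ≡⟨ ∑-cong (allFin k) (λ c → trans (cong (⟦ c == u zero ⟧ *_) (count-≐ᵇ m k (u ∘ suc))) (*-identityʳ _)) ⟩
  ∑[ c ← allFin k ] ⟦ c == u zero ⟧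
    ≡⟨ ∑-allFin-== (u zero) ⟩
  1 ∎
  where open ≡-Reasoning

record Transfer {m n k} (P : Colouring m k → Bool) (Q : Colouring n k → Bool) : Set where
  field
    to       : Colouring m k → Colouring n k
    from     : Colouring n k → Colouring m k
    to-ext   : ∀ {h h′} → h ≗ h′ → to h ≗ to h′
    from-ext : ∀ {f f′} → f ≗ f′ → from f ≗ from f′
    Q-ext    : Extensional Q
    from∘to  : ∀ h → from (to h) ≗ h
    to∘from  : ∀ f → T (Q f) → to (from f) ≗ f
    Q∘to     : ∀ h → Q (to h) ≡ P h

-- Both counts equal the number of pairs (h , f) with P h and f ≗ to h.
count-transfer : {P : Colouring m k → Bool} {Q : Colouring n k → Bool} →
  Transfer P Q → count m k P ≡ count n k Q
count-transfer {m} {k} {n} {P} {Q} tr = begin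
  count m k P
    ≡⟨ ∑-cong Hs (λ h → unit (P h) (count-≐ᵇ n k (to h))) ⟨
  ∑[ h ← Hs ] (⟦ P h ⟧ * count n k (_≐ᵇ to h))
    ≡⟨ ∑-cong Hs (λ h → ∑-*ˡ Fs ⟦ P h ⟧ _) ⟨
  ∑[ h ← Hs ] ∑[ f ← Fs ] (⟦ P h ⟧ * ⟦ f ≐ᵇ to h ⟧)
    ≡⟨ ∑-cong Hs (λ h → ∑-cong Fs (λ f →
         trans (sym (⟦∧⟧ (P h) _)) (trans (cong ⟦_⟧ (same-pairs f h)) (⟦∧⟧ (Q f) _)))) ⟩
  ∑[ h ← Hs ] ∑[ f ← Fs ] (⟦ Q f ⟧ * ⟦ h ≐ᵇ from f ⟧)
    ≡⟨ ∑-comm Hs Fs _ ⟩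
  ∑[ f ← Fs ] ∑[ h ← Hs ] (⟦ Q f ⟧ * ⟦ h ≐ᵇ from f ⟧)
    ≡⟨ ∑-cong Fs (λ f → ∑-*ˡ Hs ⟦ Q f ⟧ _) ⟩
  ∑[ f ← Fs ] (⟦ Q f ⟧ * count m k (_≐ᵇ from f))
    ≡⟨ ∑-cong Fs (λ f → unit (Q f) (count-≐ᵇ m k (from f))) ⟩
  count n k Q ∎
  where
  open ≡-Reasoning
  open Transfer tr
  Hs = allFuns m k
  Fs = allFuns n k
  unit : ∀ a {c} → c ≡ 1 → ⟦ a ⟧ * c ≡ ⟦ a ⟧
  unit a refl = *-identityʳ ⟦ a ⟧
  same-pairs : ∀ f h → (P h ∧ (f ≐ᵇ to h)) ≡ (Q f ∧ (h ≐ᵇ from f))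
  same-pairs f h = T-ext
    (λ p → let (ph , f≐) = T-∧⁻ p ; f≗ = ≐ᵇ⇒≗ f≐ in
           T-∧⁺ (subst T (sym (trans (Q-ext f≗) (Q∘to h))) ph)
                (≗⇒≐ᵇ λ i → sym (trans (from-ext f≗ i) (from∘to h i))))
    (λ p → let (qf , h≐) = T-∧⁻ p ; h≗ = ≐ᵇ⇒≗ h≐
               to-h≗f : to h ≗ f
               to-h≗f i = trans (to-ext h≗ i) (to∘from f qf i) in
           T-∧⁺ (subst T (trans (sym (Q-ext to-h≗f)) (Q∘to h)) qf)
                (≗⇒≐ᵇ λ i → sym (to-h≗f i)))

module Merge {a b : Fin (suc m)} (a≢b : a ≢ b) where

  b≢a : b ≢ a
  b≢a = a≢b ∘ sym

  merge : Fin (suc m) → Fin m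
  merge x with b ≟ᶠ x
  ... | yes _   = punchOut b≢a
  ... | no b≢x = punchOut b≢x

  merge-≢ : ∀ {x} (b≢x : b ≢ x) → merge x ≡ punchOut b≢x
  merge-≢ {x} b≢x with b ≟ᶠ x
  ... | yes b≡x = ⊥-elim (b≢x b≡x)
  ... | no _    = punchOut-cong b refl

  merge-≡ : ∀ {x} → b ≡ x → merge x ≡ punchOut b≢a
  merge-≡ {x} b≡x with b ≟ᶠ x
  ... | yes _   = refl
  ... | no b≢x = ⊥-elim (b≢x b≡x)

  merge-a≡merge-b : merge a ≡ merge b
  merge-a≡merge-b = trans (merge-≢ b≢a) (sym (merge-≡ refl))

  merge-punchIn : ∀ i → merge (punchIn b i) ≡ i
  merge-punchIn i = trans (merge-≢ (punchInᵢ≢i b i ∘ sym)) (punchOut-punchIn b)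

  punchIn-merge : ∀ {f : Colouring (suc m) k} → f a ≡ f b → ∀ x → f (punchIn b (merge x)) ≡ f x
  punchIn-merge {f = f} fa≡fb x with b ≟ᶠ x
  ... | yes refl = trans (cong f (punchIn-punchOut b≢a)) fa≡fb
  ... | no b≢x   = cong f (punchIn-punchOut b≢x)

  count-merge : ∀ (R : Colouring (suc m) k → Bool) → Extensional R →
    count (suc m) k (λ f → (f a == f b) ∧ R f) ≡ count m k (λ h → R (h ∘ merge))
  count-merge R R-ext = sym (count-transfer record
    { to       = _∘ merge
    ; from     = _∘ punchIn b
    ; to-ext   = λ e → e ∘ merge
    ; from-ext = λ e → e ∘ punchIn b
    ; Q-ext    = λ {f} {f′} e → cong₂ _∧_ (cong₂ _==_ (e a) (e b)) (R-ext e)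
    ; from∘to  = λ h i → cong h (merge-punchIn i)
    ; to∘from  = λ f q → punchIn-merge (==⇒≡ (proj₁ (T-∧⁻ q)))
    ; Q∘to     = λ h → cong (_∧ R (h ∘ merge)) (T-ext (λ _ → _) (λ _ → ≡⇒== (cong h merge-a≡merge-b)))
    })

count-== : ∀ k {a b : Fin (suc m)} → a ≢ b → count (suc m) k (λ f → f a == f b) ≡ k ^ m
count-== {m} k {a} {b} a≢b = begin
  count (suc m) k (λ f → f a == f b)
    ≡⟨ ∑-cong (allFuns (suc m) k) (λ f → cong ⟦_⟧ (∧-identityʳ (f a == f b))) ⟨
  count (suc m) k (λ f → (f a == f b) ∧ true)
    ≡⟨ count-merge a≢b (λ _ → true) (λ _ → refl) ⟩
  ∑[ _ ← allFuns m k ] 1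
    ≡⟨ count-true m k ⟩
  k ^ m ∎
  where open ≡-Reasoning; open Merge

-- The merge of b into a keeps c and d apart, so the second constraint survives as one equation.
count-==-== : ∀ k {a b c d : Fin (suc (suc m))} → a ≢ b → c ≢ d → c ≢ a → c ≢ b →
  count (suc (suc m)) k (λ f → (f a == f b) ∧ (f c == f d)) ≡ k ^ m
count-==-== {m} k {a} {b} {c} {d} a≢b c≢d c≢a c≢b =
  trans (count-merge {k = k} (λ f → f c == f d) (λ e → cong₂ _==_ (e c) (e d)))
        (count-== k merge-c≢merge-d)
  where
  open Merge a≢b
  b≢c : b ≢ c
  b≢c = c≢b ∘ sym
  merge-c≢merge-d : merge c ≢ merge d
  merge-c≢merge-d e = case b ≟ᶠ d of λ where
    (yes b≡d) → c≢a (punchOut-injective b≢c b≢a (trans (sym (merge-≢ b≢c)) (trans e (merge-≡ b≡d))))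
    (no b≢d)  → c≢d (punchOut-injective b≢c b≢d (trans (sym (merge-≢ b≢c)) (trans e (merge-≢ b≢d))))

count-two-pairs : ∀ k {a b c d : Fin (2 + m)} → a ≢ b → c ≢ d → (c ≢ a × c ≢ b) ⊎ (d ≢ a × d ≢ b) →
  count (2 + m) k (λ f → (f a == f b) ∧ (f c == f d)) ≡ k ^ m
count-two-pairs k a≢b c≢d (inj₁ (c≢a , c≢b)) = count-==-== k a≢b c≢d c≢a c≢b
count-two-pairs {m} k {a} {b} {c} {d} a≢b c≢d (inj₂ (d≢a , d≢b)) =
  trans (∑-cong (allFuns (2 + m) k) (λ f → cong (λ x → ⟦ (f a == f b) ∧ x ⟧) (==-sym (f c) (f d))))
        (count-==-== k a≢b (c≢d ∘ sym) d≢a d≢b)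

lookupL-∈ : ∀ (xs : List A) i → lookupL xs i ∈ xs
lookupL-∈ (x ∷ xs) zero    = here refl
lookupL-∈ (x ∷ xs) (suc i) = there (lookupL-∈ xs i)

lookupL-index : ∀ {xs : List A} {x} (x∈xs : x ∈ xs) → lookupL xs (Any.index x∈xs) ≡ x
lookupL-index (here refl)  = refl
lookupL-index (there x∈xs) = lookupL-index x∈xs

lookupL-injective : ∀ {xs : List A} → Unique xs → ∀ {i j} → lookupL xs i ≡ lookupL xs j → i ≡ j
lookupL-injective {xs = x ∷ xs} _            {zero}  {zero}  _ = refl
lookupL-injective {xs = x ∷ xs} (x∉ ∷ _)     {zero}  {suc j} e = ⊥-elim (All.lookup x∉ (lookupL-∈ xs j) e)
lookupL-injective {xs = x ∷ xs} (x∉ ∷ _)     {suc i} {zero}  e = ⊥-elim (All.lookup x∉ (lookupL-∈ xs i) (sym e))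
lookupL-injective {xs = x ∷ xs} (_ ∷ unique) {suc i} {suc j} e = cong suc (lookupL-injective unique e)

minFin-≤ˡ : ∀ (a b : Fin n) → toℕ (minFin a b) ≤ toℕ a
minFin-≤ˡ a b with toℕ a ≤ᵇ toℕ b in eq
... | true  = ≤-refl
... | false = ≰⇒≥ (λ a≤b → subst T eq (≤⇒≤ᵇ a≤b))

minFin-≤ʳ : ∀ (a b : Fin n) → toℕ (minFin a b) ≤ toℕ b
minFin-≤ʳ a b with toℕ a ≤ᵇ toℕ b in eq
... | true  = ≤ᵇ⇒≤ (toℕ a) (toℕ b) (subst T (sym eq) _)
... | false = ≤-refl

minFin-∈ : ∀ (a b : Fin n) → minFin a b ≡ a ⊎ minFin a b ≡ b
minFin-∈ a b with toℕ a ≤ᵇ toℕ b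
... | true  = inj₁ refl
... | false = inj₂ refl

foldr-minFin-∈ : ∀ (i : Fin n) xs → foldr minFin i xs ∈ i ∷ xs
foldr-minFin-∈ i []       = here refl
foldr-minFin-∈ i (x ∷ xs) with minFin-∈ x (foldr minFin i xs)
... | inj₁ e = there (here e)
... | inj₂ e with foldr-minFin-∈ i xs
...   | here e′  = here (trans e e′)
...   | there m = there (there (subst (_∈ xs) (sym e) m))

foldr-minFin-≤ : ∀ (i : Fin n) xs {x} → x ∈ i ∷ xs → toℕ (foldr minFin i xs) ≤ toℕ x
foldr-minFin-≤ i []       (here refl)         = ≤-refl
foldr-minFin-≤ i (y ∷ xs) (here refl)         = ≤-trans (minFin-≤ʳ y _) (foldr-minFin-≤ i xs (here refl))
foldr-minFin-≤ i (y ∷ xs) (there (here refl)) = minFin-≤ˡ y _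
foldr-minFin-≤ i (y ∷ xs) (there (there x∈)) = ≤-trans (minFin-≤ʳ y _) (foldr-minFin-≤ i xs (there x∈))

opaque
  invariantᵇ : Permutation′ n → Colouring n k → Bool
  invariantᵇ g f = all (λ u → f (g ⟨$⟩ʳ u) == f u) (allFin _)

  invariantᵇ⁻ : ∀ (g : Permutation′ n) {f : Colouring n k} →
                T (invariantᵇ g f) → ∀ u → f (g ⟨$⟩ʳ u) ≡ f u
  invariantᵇ⁻ g p u = ==⇒≡ (all-allFin⁻ _ p u)

  invariantᵇ⁺ : ∀ (g : Permutation′ n) {f : Colouring n k} →
                (∀ u → f (g ⟨$⟩ʳ u) ≡ f u) → T (invariantᵇ g f)
  invariantᵇ⁺ g inv = all-allFin⁺ _ (≡⇒== ∘ inv)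

invariantᵇ-ext : ∀ (g : Permutation′ n) → Extensional {k = k} (invariantᵇ g)
invariantᵇ-ext g e = T-ext
  (λ p → invariantᵇ⁺ g λ u → trans (sym (e _)) (trans (invariantᵇ⁻ g p u) (e u)))
  (λ p → invariantᵇ⁺ g λ u → trans (e _) (trans (invariantᵇ⁻ g p u) (sym (e u))))

module Cycles (g : Permutation′ n) where

  iter-+ : ∀ a b i → iter g (a + b) i ≡ iter g a (iter g b i)
  iter-+ zero    b i = refl
  iter-+ (suc a) b i = cong (g ⟨$⟩ʳ_) (iter-+ a b i)

  ⟨$⟩ʳ-injective : ∀ {x y} → g ⟨$⟩ʳ x ≡ g ⟨$⟩ʳ y → x ≡ y
  ⟨$⟩ʳ-injective e = trans (sym (inverseˡ g)) (trans (cong (g ⟨$⟩ˡ_) e) (inverseˡ g))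

  iter-injective : ∀ a {x y} → iter g a x ≡ iter g a y → x ≡ y
  iter-injective zero    e = e
  iter-injective (suc a) e = iter-injective a (⟨$⟩ʳ-injective e)

  iter-multiple : ∀ {p i} → iter g p i ≡ i → ∀ q → iter g (q * p) i ≡ i
  iter-multiple e zero    = refl
  iter-multiple {p} {i} e (suc q) = trans (iter-+ p (q * p) i) (trans (cong (iter g p) (iter-multiple e q)) e)

  -- Among g⁰ i, …, gⁿ i two points coincide.
  period : ∀ i → ∃ λ p → 0 < p × p ≤ n × iter g p i ≡ i
  period i with x , y , x<y , e ← pigeonhole (n<1+n n) (λ (x : Fin (suc n)) → iter g (toℕ x) i) =
    toℕ y ∸ toℕ x , m<n⇒0<n∸m x<y , ≤-trans (m∸n≤m (toℕ y) (toℕ x)) (≤-pred (toℕ<n y)) ,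
    iter-injective (toℕ x) (sym (begin
      iter g (toℕ x) i                       ≡⟨ e ⟩
      iter g (toℕ y) i                       ≡⟨ cong (λ z → iter g z i) (m∸n+n≡m (<⇒≤ x<y)) ⟨
      iter g (toℕ y ∸ toℕ x + toℕ x) i       ≡⟨ cong (λ z → iter g z i) (+-comm _ (toℕ x)) ⟩
      iter g (toℕ x + (toℕ y ∸ toℕ x)) i     ≡⟨ iter-+ (toℕ x) _ i ⟩
      iter g (toℕ x) (iter g (toℕ y ∸ toℕ x) i) ∎))
    where open ≡-Reasoning

  _∼_ : Fin n → Fin n → Set
  i ∼ j = ∃ λ a → iter g a i ≡ j

  ∼-trans : ∀ {i j l} → i ∼ j → j ∼ l → i ∼ l
  ∼-trans {i} (a , e) (b , e′) = b + a , trans (iter-+ b a i) (trans (cong (iter g b) e) e′)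

  ∼-sym : ∀ {i j} → i ∼ j → j ∼ i
  ∼-sym {i} (a , refl) with p , 0<p , _ , e ← period i =
    a * p ∸ a , (begin
      iter g (a * p ∸ a) (iter g a i) ≡⟨ iter-+ (a * p ∸ a) a i ⟨
      iter g (a * p ∸ a + a) i        ≡⟨ cong (λ z → iter g z i) (m∸n+n≡m (m≤m*n a p {{ℕ.>-nonZero 0<p}})) ⟩
      iter g (a * p) i                ≡⟨ iter-multiple e a ⟩
      i                               ∎)
    where open ≡-Reasoning

  ∈-orbit⁻ : ∀ {i j} → j ∈ orbit g i → i ∼ j
  ∈-orbit⁻ {i} j∈ with a , _ , e ← ∈-map⁻ (λ b → iter g b i) j∈ = a , sym e

  ∈-orbit⁺ : ∀ {i j} → i ∼ j → j ∈ orbit g i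
  ∈-orbit⁺ {i} (a , refl) with p , 0<p , p≤n , e ← period i =
    subst (_∈ orbit g i) a%p-step (∈-map⁺ (λ b → iter g b i) (∈-upTo⁺ (≤-trans (m%n<n a p) p≤n)))
    where
    instance _ = ℕ.>-nonZero 0<p
    a%p-step : iter g (a % p) i ≡ iter g a i
    a%p-step = sym (begin
      iter g a i                           ≡⟨ cong (λ z → iter g z i) (m≡m%n+[m/n]*n a p) ⟩
      iter g (a % p + a / p * p) i         ≡⟨ iter-+ (a % p) _ i ⟩
      iter g (a % p) (iter g (a / p * p) i) ≡⟨ cong (iter g (a % p)) (iter-multiple e (a / p)) ⟩
      iter g (a % p) i                     ∎)
      where open ≡-Reasoning

  ∼-rep : ∀ i → i ∼ rep g i
  ∼-rep i with foldr-minFin-∈ i (orbit g i)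
  ... | here e     = 0 , sym e
  ... | there r∈ = ∈-orbit⁻ r∈

  rep-≤ : ∀ {i j} → i ∼ j → toℕ (rep g i) ≤ toℕ j
  rep-≤ {i} i∼j = foldr-minFin-≤ i (orbit g i) (there (∈-orbit⁺ i∼j))

  rep-cong : ∀ {i j} → i ∼ j → rep g i ≡ rep g j
  rep-cong i∼j = toℕ-injective (≤-antisym
    (rep-≤ (∼-trans i∼j (∼-rep _)))
    (rep-≤ (∼-trans (∼-sym i∼j) (∼-rep _))))

  rep-⟨$⟩ʳ : ∀ u → rep g (g ⟨$⟩ʳ u) ≡ rep g u
  rep-⟨$⟩ʳ u = sym (rep-cong (1 , refl))

  isRep-rep : ∀ i → T (isRep g (rep g i))
  isRep-rep i = all⁻ _ (All.tabulate λ j∈ →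
    ≤⇒≤ᵇ (rep-≤ (∼-trans (∼-rep i) (∈-orbit⁻ j∈))))

  isRep⇒rep≡ : ∀ {r} → T (isRep g r) → rep g r ≡ r
  isRep⇒rep≡ {r} isRep-r = toℕ-injective (≤-antisym
    (rep-≤ (0 , refl))
    (≤ᵇ⇒≤ (toℕ r) _ (All.lookup (all⁺ _ (orbit g r) isRep-r) (∈-orbit⁺ (∼-rep r)))))

  invariant-rep : ∀ {X : Set} (f : Fin n → X) → (∀ u → f (g ⟨$⟩ʳ u) ≡ f u) → ∀ i → f (rep g i) ≡ f i
  invariant-rep f inv i with a , e ← ∼-rep i = trans (cong f (sym e)) (invariant-iter a)
    where
    invariant-iter : ∀ a → f (iter g a i) ≡ f i
    invariant-iter zero    = refl
    invariant-iter (suc a) = trans (inv _) (invariant-iter a)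

  reps-unique : Unique (reps g)
  reps-unique = filter⁺ (T? ∘ isRep g) (allFin⁺ n)

  rep∈reps : ∀ u → rep g u ∈ reps g
  rep∈reps u = ∈-filter⁺ (T? ∘ isRep g) (∈-allFin (rep g u)) (isRep-rep u)

  cycleOf : Fin n → Fin (cycles g)
  cycleOf u = Any.index (rep∈reps u)

  representative : Fin (cycles g) → Fin n
  representative = lookupL (reps g)

  representative-cycleOf : ∀ u → representative (cycleOf u) ≡ rep g u
  representative-cycleOf u = lookupL-index (rep∈reps u)

  cycleOf-≡ : ∀ u a → rep g u ≡ representative a → cycleOf u ≡ a
  cycleOf-≡ u a e = lookupL-injective reps-unique (trans (representative-cycleOf u) e)

  cycleOf-representative : ∀ a → cycleOf (representative a) ≡ a
  cycleOf-representative a =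
    cycleOf-≡ _ a (isRep⇒rep≡ (proj₂ (∈-filter⁻ (T? ∘ isRep g) {xs = allFin n} (lookupL-∈ (reps g) a))))

  cycleOf-⟨$⟩ʳ : ∀ u → cycleOf (g ⟨$⟩ʳ u) ≡ cycleOf u
  cycleOf-⟨$⟩ʳ u = cycleOf-≡ _ _ (trans (rep-⟨$⟩ʳ u) (sym (representative-cycleOf u)))

  -- Colourings of Γ/g are the g-invariant colourings of the vertices of Γ.
  count-lift : ∀ (R : Colouring (cycles g) k → Bool) (R′ : Colouring n k → Bool) → Extensional R′ →
    (∀ h → R′ (h ∘ cycleOf) ≡ R h) → count (cycles g) k R ≡ count n k (λ f → invariantᵇ g f ∧ R′ f)
  count-lift R R′ R′-ext R′-lift = count-transfer record
    { to       = _∘ cycleOf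
    ; from     = _∘ representative
    ; to-ext   = λ e → e ∘ cycleOf
    ; from-ext = λ e → e ∘ representative
    ; Q-ext    = λ e → cong₂ _∧_ (invariantᵇ-ext g e) (R′-ext e)
    ; from∘to  = λ h a → cong h (cycleOf-representative a)
    ; to∘from  = λ f q u → trans (cong f (representative-cycleOf u))
                                 (invariant-rep f (invariantᵇ⁻ g (proj₁ (T-∧⁻ q))) u)
    ; Q∘to     = λ h → cong₂ _∧_ (T-ext (λ _ → _) (λ _ → invariantᵇ⁺ g (cong h ∘ cycleOf-⟨$⟩ʳ))) (R′-lift h)
    }

  ^cycles≡count : ∀ k → k ^ cycles g ≡ count n k (invariantᵇ g)
  ^cycles≡count k = begin
    k ^ cycles g                                      ≡⟨ count-true (cycles g) k ⟨
    count (cycles g) k (λ _ → true)                   ≡⟨ count-lift (λ _ → true) (λ _ → true) (λ _ → refl) (λ _ → refl) ⟩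
    count n k (λ f → invariantᵇ g f ∧ true)           ≡⟨ ∑-cong (allFuns n k) (λ f → cong ⟦_⟧ (∧-identityʳ (invariantᵇ g f))) ⟩
    count n k (invariantᵇ g)                          ∎
    where open ≡-Reasoning

2^-injective : ∀ {a b} → 2 ^ a ≡ 2 ^ b → a ≡ b
2^-injective {a} {b} e with <-cmp a b
... | tri< a<b _ _ = ⊥-elim (<-irrefl e (^-monoʳ-< 2 (s≤s (s≤s z≤n)) a<b))
... | tri≈ _ a≡b _ = a≡b
... | tri> _ _ b<a = ⊥-elim (<-irrefl (sym e) (^-monoʳ-< 2 (s≤s (s≤s z≤n)) b<a))

cycles≡ : ∀ {g : Permutation′ n} {c} → count n 2 (invariantᵇ g) ≡ 2 ^ c → cycles g ≡ c
cycles≡ {g = g} e = 2^-injective (trans (Cycles.^cycles≡count g 2) e)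

Proper : (Fin m → Fin m → Bool) → Colouring m k → Set
Proper a f = ∀ i j → T (a i j) → f i ≢ f j

properᵇ⁻ : ∀ (a : Fin m → Fin m → Bool) (f : Colouring m k) → T (properᵇ a f) → Proper a f
properᵇ⁻ a f p i j aij fi≡fj = nand⁻ (all-allFin⁻ _ (all-allFin⁻ _ p i) j) aij (≡⇒== fi≡fj)

properᵇ⁺ : ∀ (a : Fin m → Fin m → Bool) (f : Colouring m k) → Proper a f → T (properᵇ a f)
properᵇ⁺ a f proper = all-allFin⁺ _ λ i → all-allFin⁺ _ λ j →
  nand⁺ λ aij fi==fj → proper i j aij (==⇒≡ fi==fj)

properᵇ-ext : ∀ (a : Fin m → Fin m → Bool) → Extensional {k = k} (properᵇ a)
properᵇ-ext a {f} {f′} e = T-ext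
  (λ p → properᵇ⁺ a f′ λ i j aij q → properᵇ⁻ a f p i j aij (trans (e i) (trans q (sym (e j)))))
  (λ p → properᵇ⁺ a f λ i j aij q → properᵇ⁻ a f′ p i j aij (trans (sym (e i)) (trans q (e j))))

module Quotient (Γ : SimpleGraph n) (g : Permutation′ n) where
  open Cycles g

  quotAdj⁻ : ∀ {a b} → T (quotAdj Γ g a b) →
    ∃ λ u → ∃ λ v → T (adj Γ u v) × cycleOf u ≡ a × cycleOf v ≡ b
  quotAdj⁻ {a} {b} q
    with u , q₁ ← any-allFin⁻ _ q
    with v , q₂ ← any-allFin⁻ _ q₁
    with uv , q₃ ← T-∧⁻ {adj Γ u v} q₂
    with ru , rv ← T-∧⁻ {rep g u == representative a} q₃
    = u , v , uv , cycleOf-≡ u a (==⇒≡ ru) , cycleOf-≡ v b (==⇒≡ rv)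

  quotAdj⁺ : ∀ {u v} → T (adj Γ u v) → T (quotAdj Γ g (cycleOf u) (cycleOf v))
  quotAdj⁺ {u} {v} uv = any-allFin⁺ _ u (any-allFin⁺ _ v
    (T-∧⁺ uv (T-∧⁺ (≡⇒== (sym (representative-cycleOf u))) (≡⇒== (sym (representative-cycleOf v))))))

  proper-lift : ∀ (h : Colouring (cycles g) k) → properᵇ (adj Γ) (h ∘ cycleOf) ≡ properᵇ (quotAdj Γ g) h
  proper-lift h = T-ext
    (λ p → properᵇ⁺ (quotAdj Γ g) h λ a b q → case quotAdj⁻ q of λ where
      (u , v , uv , refl , refl) → properᵇ⁻ (adj Γ) (h ∘ cycleOf) p u v uv)
    (λ p → properᵇ⁺ (adj Γ) (h ∘ cycleOf) λ u v uv → properᵇ⁻ (quotAdj Γ g) h p _ _ (quotAdj⁺ uv))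

  chromQuot≡count : ∀ k → chromQuot Γ g k ≡ count n k (λ f → invariantᵇ g f ∧ properᵇ (adj Γ) f)
  chromQuot≡count k = trans (length-filterᵇ (properᵇ (quotAdj Γ g)) (allFuns (cycles g) k))
    (count-lift (properᵇ (quotAdj Γ g)) (properᵇ (adj Γ)) (properᵇ-ext (adj Γ)) proper-lift)

∈-pair? : ∀ (x i j : Fin n) → (x ≡ i ⊎ x ≡ j) ⊎ (x ≢ i × x ≢ j)
∈-pair? x i j with x ≟ᶠ i | x ≟ᶠ j
... | yes x≡i | _       = inj₁ (inj₁ x≡i)
... | no _    | yes x≡j = inj₁ (inj₂ x≡j)
... | no x≢i  | no x≢j  = inj₂ (x≢i , x≢j)

module Edges (Γ : SimpleGraph n) where

  edge : Fin n → Fin n → Bool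
  edge i j = (toℕ i <ᵇ toℕ j) ∧ adj Γ i j

  numEdges≡ : numEdges Γ ≡ ∑² n (λ i j → ⟦ edge i j ⟧)
  numEdges≡ = begin
    numEdges Γ
      ≡⟨ length-filterᵇ (λ ij → edge (proj₁ ij) (proj₂ ij)) (concatMap (λ i → map (i ,_) (allFin n)) (allFin n)) ⟩
    ∑ (concatMap (λ i → map (i ,_) (allFin n)) (allFin n)) _
      ≡⟨ ∑-concatMap (λ i → map (i ,_) (allFin n)) (allFin n) _ ⟩
    ∑[ i ← allFin n ] ∑ (map (i ,_) (allFin n)) _
      ≡⟨ ∑-cong (allFin n) (λ i → ∑-map (i ,_) (allFin n) _) ⟩
    ∑² n (λ i j → ⟦ edge i j ⟧) ∎
    where open ≡-Reasoning

  ∑²-edge : ∀ c → ∑² n (λ i j → ⟦ edge i j ⟧ * c) ≡ numEdges Γ * c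
  ∑²-edge c = trans (∑²-*ʳ (λ i j → ⟦ edge i j ⟧) c) (cong (_* c) (sym numEdges≡))

  ∑²-edge-≤ : ∀ {F : Fin n → Fin n → ℕ} c → (∀ {i j} → T (edge i j) → F i j ≤ c) →
    ∑² n (λ i j → ⟦ edge i j ⟧ * F i j) ≤ numEdges Γ * c
  ∑²-edge-≤ c bound = ≤-trans (∑²-mono (λ i j → ⟦⟧*-mono (edge i j) bound)) (≤-reflexive (∑²-edge c))

  edge⇒adj : ∀ {i j} → T (edge i j) → T (adj Γ i j)
  edge⇒adj e = proj₂ (T-∧⁻ e)

  edge⇒< : ∀ {i j} → T (edge i j) → toℕ i < toℕ j
  edge⇒< e = <ᵇ⇒< _ _ (proj₁ (T-∧⁻ e))

  edge⇒≢ : ∀ {i j} → T (edge i j) → i ≢ j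
  edge⇒≢ e refl = <-irrefl refl (edge⇒< e)

  adj⇒edge : ∀ {i j} → T (adj Γ i j) → T (edge i j) ⊎ T (edge j i)
  adj⇒edge {i} {j} ij with <-cmp (toℕ i) (toℕ j)
  ... | tri< i<j _ _ = inj₁ (T-∧⁺ (<⇒<ᵇ i<j) ij)
  ... | tri≈ _ i≡j _ = ⊥-elim (subst T (trans (cong (adj Γ i) (sym (toℕ-injective i≡j))) (irrefl Γ i)) ij)
  ... | tri> _ _ j<i = inj₂ (T-∧⁺ (<⇒<ᵇ j<i) (subst T (adj-sym Γ i j) ij))

  edges-apart : ∀ {i j i′ j′} → T (edge i j) → T (edge i′ j′) → ¬ (i′ ≡ i × j′ ≡ j) →
    (i′ ≢ i × i′ ≢ j) ⊎ (j′ ≢ i × j′ ≢ j)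
  edges-apart {i} {j} {i′} {j′} e e′ ne with ∈-pair? i′ i j | ∈-pair? j′ i j
  ... | inj₂ i′∉ | _       = inj₁ i′∉
  ... | inj₁ _   | inj₂ j′∉ = inj₂ j′∉
  ... | inj₁ (inj₁ refl) | inj₁ (inj₁ refl) = ⊥-elim (edge⇒≢ e′ refl)
  ... | inj₁ (inj₁ refl) | inj₁ (inj₂ refl) = ⊥-elim (ne (refl , refl))
  ... | inj₁ (inj₂ refl) | inj₁ (inj₁ refl) = ⊥-elim (<-asym (edge⇒< e) (edge⇒< e′))
  ... | inj₁ (inj₂ refl) | inj₁ (inj₂ refl) = ⊥-elim (edge⇒≢ e′ refl)

  non-edge-apart : ∀ {a b i j} → ¬ T (adj Γ a b) → T (edge i j) → (i ≢ a × i ≢ b) ⊎ (j ≢ a × j ≢ b)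
  non-edge-apart {a} {b} {i} {j} ¬ab e with ∈-pair? i a b | ∈-pair? j a b
  ... | inj₂ i∉ | _       = inj₁ i∉
  ... | inj₁ _  | inj₂ j∉ = inj₂ j∉
  ... | inj₁ (inj₁ refl) | inj₁ (inj₁ refl) = ⊥-elim (edge⇒≢ e refl)
  ... | inj₁ (inj₁ refl) | inj₁ (inj₂ refl) = ⊥-elim (¬ab (edge⇒adj e))
  ... | inj₁ (inj₂ refl) | inj₁ (inj₁ refl) = ⊥-elim (¬ab (subst T (adj-sym Γ i j) (edge⇒adj e)))
  ... | inj₁ (inj₂ refl) | inj₁ (inj₂ refl) = ⊥-elim (edge⇒≢ e refl)

2[1+s]≤1+[1+s]² : ∀ s → 2 * (1 + s) ≤ 1 + (1 + s) * (1 + s)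
2[1+s]≤1+[1+s]² s = ≤-trans (m≤m+n (2 * (1 + s)) (s * s)) (≤-reflexive (square-expansion s))
  where
  square-expansion : ∀ s → 2 * (1 + s) + s * s ≡ 1 + (1 + s) * (1 + s)
  square-expansion = solve-∀

-- With s the number of monochromatic edges of f, the Bonferroni inequalities
-- 1 ≤ [f proper] + s and [f proper] + 2 s ≤ 1 + s², summed over all f, determine the number
-- of proper colourings up to O(k ^ n); the sums of s and s² are found by counting colourings
-- that are constant on one or two edges.
module ProperColourings (Γ : SimpleGraph (2 + n)) (k : ℕ) where
  open Edges Γ

  Fs : List (Colouring (2 + n) k)
  Fs = allFuns (2 + n) k

  proper : Colouring (2 + n) k → Bool
  proper = properᵇ (adj Γ)

  monochromatic : Colouring (2 + n) k → ℕ
  monochromatic f = ∑² (2 + n) (λ i j → ⟦ edge i j ⟧ * ⟦ f i == f j ⟧)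

  monochromatic-adj : ∀ {f i j} → T (adj Γ i j) → f i ≡ f j → 1 ≤ monochromatic f
  monochromatic-adj {f} {i} {j} ij fi≡fj with adj⇒edge ij
  ... | inj₁ e = ≤-trans (≤-reflexive (sym (cong₂ _*_ (⟦⟧-true e) (⟦⟧-true (≡⇒== fi≡fj)))))
                         (∑²-term (λ i j → ⟦ edge i j ⟧ * ⟦ f i == f j ⟧) i j)
  ... | inj₂ e = ≤-trans (≤-reflexive (sym (cong₂ _*_ (⟦⟧-true e) (⟦⟧-true (≡⇒== (sym fi≡fj))))))
                         (∑²-term (λ i j → ⟦ edge i j ⟧ * ⟦ f i == f j ⟧) j i)

  proper⇒monochromatic≡0 : ∀ {f} → T (proper f) → monochromatic f ≡ 0
  proper⇒monochromatic≡0 {f} p = ∑²-zero λ i j →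
    trans (⟦⟧*-cong (edge i j) (λ e → ⟦⟧-false (properᵇ⁻ (adj Γ) f p i j (edge⇒adj e) ∘ ==⇒≡))) (*-zeroʳ ⟦ edge i j ⟧)

  bonferroni-lower : ∀ f → 1 ≤ ⟦ proper f ⟧ + monochromatic f
  bonferroni-lower f with monochromatic f in eq
  ... | suc _ = ≤-trans (s≤s z≤n) (m≤n+m _ _)
  ... | zero  = ≤-reflexive (sym (trans (+-identityʳ _) (⟦⟧-true (properᵇ⁺ (adj Γ) f λ i j ij fi≡fj →
                    case subst (1 ≤_) eq (monochromatic-adj {f} ij fi≡fj) of λ ()))))

  bonferroni-upper : ∀ f → ⟦ proper f ⟧ + 2 * monochromatic f ≤ 1 + monochromatic f * monochromatic f
  bonferroni-upper f with monochromatic f in eq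
  ... | zero  = +-mono-≤ (⟦⟧≤1 (proper f)) z≤n
  ... | suc s = ≤-trans (≤-reflexive (cong (_+ 2 * suc s) improper)) (2[1+s]≤1+[1+s]² s)
    where
    improper : ⟦ proper f ⟧ ≡ 0
    improper = ⟦⟧-false λ p → case trans (sym eq) (proper⇒monochromatic≡0 {f} p) of λ ()

  ∑-*-monochromatic : ∀ (w : Colouring (2 + n) k → ℕ) →
    ∑[ f ← Fs ] (w f * monochromatic f) ≡ ∑² (2 + n) (λ i j → ⟦ edge i j ⟧ * ∑[ f ← Fs ] (w f * ⟦ f i == f j ⟧))
  ∑-*-monochromatic w = begin
    ∑[ f ← Fs ] (w f * monochromatic f)
      ≡⟨ ∑-cong Fs (λ f → ∑²-*ˡ (w f) (λ i j → ⟦ edge i j ⟧ * ⟦ f i == f j ⟧)) ⟨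
    ∑[ f ← Fs ] ∑² (2 + n) (λ i j → w f * (⟦ edge i j ⟧ * ⟦ f i == f j ⟧))
      ≡⟨ ∑-∑²-comm Fs (λ f i j → w f * (⟦ edge i j ⟧ * ⟦ f i == f j ⟧)) ⟩
    ∑² (2 + n) (λ i j → ∑[ f ← Fs ] (w f * (⟦ edge i j ⟧ * ⟦ f i == f j ⟧)))
      ≡⟨ ∑²-cong (λ i j → ∑-cong Fs (λ f → *-CS.x∙yz≈y∙xz (w f) ⟦ edge i j ⟧ _)) ⟩
    ∑² (2 + n) (λ i j → ∑[ f ← Fs ] (⟦ edge i j ⟧ * (w f * ⟦ f i == f j ⟧)))
      ≡⟨ ∑²-cong (λ i j → ∑-*ˡ Fs ⟦ edge i j ⟧ _) ⟩
    ∑² (2 + n) (λ i j → ⟦ edge i j ⟧ * ∑[ f ← Fs ] (w f * ⟦ f i == f j ⟧)) ∎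
    where open ≡-Reasoning

  ∑-==-* : ∀ (w : Colouring (2 + n) k → ℕ) {i j} → i ≢ j → (∀ f → w f ≡ 1) →
    ∑[ f ← Fs ] (w f * ⟦ f i == f j ⟧) ≡ k ^ (1 + n)
  ∑-==-* w i≢j w≡1 = trans (∑-cong Fs (λ f → trans (cong (_* _) (w≡1 f)) (*-identityˡ _))) (count-== k i≢j)

  ∑monochromatic : ∑[ f ← Fs ] monochromatic f ≡ numEdges Γ * k ^ (1 + n)
  ∑monochromatic = begin
    ∑[ f ← Fs ] monochromatic f
      ≡⟨ ∑-cong Fs (λ f → *-identityˡ (monochromatic f)) ⟨
    ∑[ f ← Fs ] (1 * monochromatic f)
      ≡⟨ ∑-*-monochromatic (λ _ → 1) ⟩
    ∑² (2 + n) (λ i j → ⟦ edge i j ⟧ * ∑[ f ← Fs ] (1 * ⟦ f i == f j ⟧))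
      ≡⟨ ∑²-cong (λ i j → ⟦⟧*-cong (edge i j) (λ e → ∑-==-* (λ _ → 1) (edge⇒≢ e) (λ _ → refl))) ⟩
    ∑² (2 + n) (λ i j → ⟦ edge i j ⟧ * k ^ (1 + n))
      ≡⟨ ∑²-edge (k ^ (1 + n)) ⟩
    numEdges Γ * k ^ (1 + n) ∎
    where open ≡-Reasoning

  ∑-==-==-apart : ∀ {i j i′ j′} → T (edge i j) → T (edge i′ j′) → ¬ (i′ ≡ i × j′ ≡ j) →
    ∑[ f ← Fs ] (⟦ f i == f j ⟧ * ⟦ f i′ == f j′ ⟧) ≡ k ^ n
  ∑-==-==-apart {i} {j} e e′ ne = trans (∑-cong Fs (λ f → sym (⟦∧⟧ (f i == f j) _)))
    (count-two-pairs k (edge⇒≢ e) (edge⇒≢ e′) (edges-apart e e′ ne))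

  ∑-==-== : ∀ {i j i′ j′} → T (edge i j) → T (edge i′ j′) →
    ∑[ f ← Fs ] (⟦ f i == f j ⟧ * ⟦ f i′ == f j′ ⟧) ≤ ⟦ (i′ == i) ∧ (j′ == j) ⟧ * k ^ (1 + n) + k ^ n
  ∑-==-== {i} {j} {i′} {j′} e e′ with i′ ≟ᶠ i | j′ ≟ᶠ j
  ... | yes refl | yes refl = begin
    ∑[ f ← Fs ] (⟦ f i == f j ⟧ * ⟦ f i == f j ⟧)  ≤⟨ ∑-mono Fs (λ f → ⟦⟧*⟦⟧≤⟦⟧ (f i == f j)) ⟩
    count (2 + n) k (λ f → f i == f j)             ≡⟨ count-== k (edge⇒≢ e) ⟩
    k ^ (1 + n)                                    ≡⟨ +-identityʳ _ ⟨
    1 * k ^ (1 + n)                                ≤⟨ m≤m+n _ _ ⟩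
    1 * k ^ (1 + n) + k ^ n                        ∎
    where open ≤-Reasoning
  ... | no i′≢i | _       = ≤-trans (≤-reflexive (∑-==-==-apart e e′ (i′≢i ∘ proj₁))) (m≤n+m _ _)
  ... | yes _   | no j′≢j = ≤-trans (≤-reflexive (∑-==-==-apart e e′ (j′≢j ∘ proj₂))) (m≤n+m _ _)

  ∑-==-*-monochromatic : ∀ {i j} → T (edge i j) →
    ∑[ f ← Fs ] (⟦ f i == f j ⟧ * monochromatic f) ≤ k ^ (1 + n) + numEdges Γ * k ^ n
  ∑-==-*-monochromatic {i} {j} e = begin
    ∑[ f ← Fs ] (⟦ f i == f j ⟧ * monochromatic f)
      ≡⟨ ∑-*-monochromatic (λ f → ⟦ f i == f j ⟧) ⟩
    ∑² (2 + n) (λ i′ j′ → ⟦ edge i′ j′ ⟧ * ∑[ f ← Fs ] (⟦ f i == f j ⟧ * ⟦ f i′ == f j′ ⟧))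
      ≤⟨ ∑²-mono (λ i′ j′ → ⟦⟧*-mono (edge i′ j′) (∑-==-== e)) ⟩
    ∑² (2 + n) (λ i′ j′ → ⟦ edge i′ j′ ⟧ * (δ i′ j′ * k ^ (1 + n) + k ^ n))
      ≤⟨ ∑²-mono (λ i′ j′ → drop-weight (edge i′ j′) (δ i′ j′ * k ^ (1 + n)) (k ^ n)) ⟩
    ∑² (2 + n) (λ i′ j′ → δ i′ j′ * k ^ (1 + n) + ⟦ edge i′ j′ ⟧ * k ^ n)
      ≡⟨ ∑²-+ (λ i′ j′ → δ i′ j′ * k ^ (1 + n)) (λ i′ j′ → ⟦ edge i′ j′ ⟧ * k ^ n) ⟩
    ∑² (2 + n) (λ i′ j′ → δ i′ j′ * k ^ (1 + n)) + ∑² (2 + n) (λ i′ j′ → ⟦ edge i′ j′ ⟧ * k ^ n)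
      ≡⟨ cong₂ _+_ (trans (∑²-*ʳ δ (k ^ (1 + n))) (trans (cong (_* k ^ (1 + n)) (∑²-== i j)) (*-identityˡ _)))
                   (∑²-edge (k ^ n)) ⟩
    k ^ (1 + n) + numEdges Γ * k ^ n ∎
    where
    open ≤-Reasoning
    δ : Fin (2 + n) → Fin (2 + n) → ℕ
    δ i′ j′ = ⟦ (i′ == i) ∧ (j′ == j) ⟧
    drop-weight : ∀ b x y → ⟦ b ⟧ * (x + y) ≤ x + ⟦ b ⟧ * y
    drop-weight true  x y = ≤-reflexive (trans (*-identityˡ _) (cong (_+_ x) (sym (*-identityˡ y))))
    drop-weight false x y = z≤n

  ∑monochromatic² : ∑[ f ← Fs ] (monochromatic f * monochromatic f)
                      ≤ numEdges Γ * (k ^ (1 + n) + numEdges Γ * k ^ n)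
  ∑monochromatic² = begin
    ∑[ f ← Fs ] (monochromatic f * monochromatic f)
      ≡⟨ ∑-*-monochromatic monochromatic ⟩
    ∑² (2 + n) (λ i j → ⟦ edge i j ⟧ * ∑[ f ← Fs ] (monochromatic f * ⟦ f i == f j ⟧))
      ≤⟨ ∑²-edge-≤ _ (λ {i} {j} e → ≤-trans (≤-reflexive (∑-cong Fs (λ f → *-comm (monochromatic f) _)))
                                            (∑-==-*-monochromatic e)) ⟩
    numEdges Γ * (k ^ (1 + n) + numEdges Γ * k ^ n) ∎
    where open ≤-Reasoning

  ∑-==-*-monochromatic-non-adj : ∀ {a b} → a ≢ b → ¬ T (adj Γ a b) →
    ∑[ f ← Fs ] (⟦ f a == f b ⟧ * monochromatic f) ≡ numEdges Γ * k ^ n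
  ∑-==-*-monochromatic-non-adj {a} {b} a≢b ¬ab = begin
    ∑[ f ← Fs ] (⟦ f a == f b ⟧ * monochromatic f)
      ≡⟨ ∑-*-monochromatic (λ f → ⟦ f a == f b ⟧) ⟩
    ∑² (2 + n) (λ i j → ⟦ edge i j ⟧ * ∑[ f ← Fs ] (⟦ f a == f b ⟧ * ⟦ f i == f j ⟧))
      ≡⟨ ∑²-cong (λ i j → ⟦⟧*-cong (edge i j) λ e →
           trans (∑-cong Fs (λ f → sym (⟦∧⟧ (f a == f b) _)))
                 (count-two-pairs k a≢b (edge⇒≢ e) (non-edge-apart ¬ab e))) ⟩
    ∑² (2 + n) (λ i j → ⟦ edge i j ⟧ * k ^ n)
      ≡⟨ ∑²-edge (k ^ n) ⟩
    numEdges Γ * k ^ n ∎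
    where open ≡-Reasoning

  count-proper-lower : k ^ (2 + n) ≤ count (2 + n) k proper + numEdges Γ * k ^ (1 + n)
  count-proper-lower = begin
    k ^ (2 + n)                                     ≡⟨ count-true (2 + n) k ⟨
    ∑[ f ← Fs ] 1                                   ≤⟨ ∑-mono Fs bonferroni-lower ⟩
    ∑[ f ← Fs ] (⟦ proper f ⟧ + monochromatic f)    ≡⟨ ∑-+ Fs _ monochromatic ⟩
    count (2 + n) k proper + ∑ Fs monochromatic     ≡⟨ cong (_+_ (count (2 + n) k proper)) ∑monochromatic ⟩
    count (2 + n) k proper + numEdges Γ * k ^ (1 + n) ∎
    where open ≤-Reasoning

  count-proper-upper : count (2 + n) k proper + numEdges Γ * k ^ (1 + n)
                         ≤ k ^ (2 + n) + numEdges Γ * numEdges Γ * k ^ n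
  count-proper-upper = +-cancelʳ-≤ (e * K₁) _ _ (begin
    P + e * K₁ + e * K₁                                ≡⟨ a+b+b≡a+2b P (e * K₁) ⟩
    P + 2 * (e * K₁)                                   ≡⟨ cong (λ x → P + 2 * x) ∑monochromatic ⟨
    P + 2 * ∑ Fs monochromatic                         ≡⟨ cong (_+_ P) (∑-*ˡ Fs 2 monochromatic) ⟨
    P + ∑[ f ← Fs ] (2 * monochromatic f)              ≡⟨ ∑-+ Fs _ _ ⟨
    ∑[ f ← Fs ] (⟦ proper f ⟧ + 2 * monochromatic f)   ≤⟨ ∑-mono Fs bonferroni-upper ⟩
    ∑[ f ← Fs ] (1 + monochromatic f * monochromatic f) ≡⟨ ∑-+ Fs _ _ ⟩
    ∑[ f ← Fs ] 1 + ∑[ f ← Fs ] (monochromatic f * monochromatic f)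
                                                       ≤⟨ +-mono-≤ (≤-reflexive (count-true (2 + n) k)) ∑monochromatic² ⟩
    k ^ (2 + n) + e * (K₁ + e * K₀)                    ≡⟨ rearrange (k ^ (2 + n)) e K₁ K₀ ⟩
    k ^ (2 + n) + e * e * K₀ + e * K₁                  ∎)
    where
    open ≤-Reasoning
    e K₁ K₀ P : ℕ
    e  = numEdges Γ
    K₁ = k ^ (1 + n)
    K₀ = k ^ n
    P  = count (2 + n) k proper
    a+b+b≡a+2b : ∀ a b → a + b + b ≡ a + 2 * b
    a+b+b≡a+2b = solve-∀
    rearrange : ∀ a m x y → a + m * (x + m * y) ≡ a + m * m * y + m * x
    rearrange = solve-∀

  count-merged-proper-upper : ∀ {a b} → a ≢ b → count (2 + n) k (λ f → (f a == f b) ∧ proper f) ≤ k ^ (1 + n)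
  count-merged-proper-upper {a} {b} a≢b =
    ≤-trans (∑-mono Fs (λ f → ⟦⟧-mono (proj₁ ∘ T-∧⁻ {f a == f b}))) (≤-reflexive (count-== k a≢b))

  count-merged-proper-adj : ∀ {a b} → T (adj Γ a b) → count (2 + n) k (λ f → (f a == f b) ∧ proper f) ≡ 0
  count-merged-proper-adj {a} {b} ab = ∑-zero Fs λ f → ⟦⟧-false λ q →
    let fa≡fb , p = T-∧⁻ {f a == f b} q in properᵇ⁻ (adj Γ) f p a b ab (==⇒≡ fa≡fb)

  count-merged-proper-lower : ∀ {a b} → a ≢ b → ¬ T (adj Γ a b) →
    k ^ (1 + n) ≤ count (2 + n) k (λ f → (f a == f b) ∧ proper f) + numEdges Γ * k ^ n
  count-merged-proper-lower {a} {b} a≢b ¬ab = begin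
    k ^ (1 + n)
      ≡⟨ count-== k a≢b ⟨
    ∑[ f ← Fs ] ⟦ f a == f b ⟧
        ≤⟨ ∑-mono Fs (λ f → ≤-trans (≤-reflexive (sym (*-identityʳ _)))
                                  (*-monoʳ-≤ ⟦ f a == f b ⟧ (bonferroni-lower f))) ⟩
    ∑[ f ← Fs ] (⟦ f a == f b ⟧ * (⟦ proper f ⟧ + monochromatic f))
      ≡⟨ ∑-cong Fs (λ f → trans (*-distribˡ-+ ⟦ f a == f b ⟧ _ _)
                                (cong (_+ ⟦ f a == f b ⟧ * monochromatic f) (sym (⟦∧⟧ (f a == f b) _)))) ⟩
    ∑[ f ← Fs ] (⟦ (f a == f b) ∧ proper f ⟧ + ⟦ f a == f b ⟧ * monochromatic f)
      ≡⟨ ∑-+ Fs _ _ ⟩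
    count (2 + n) k (λ f → (f a == f b) ∧ proper f) + ∑[ f ← Fs ] (⟦ f a == f b ⟧ * monochromatic f)
      ≡⟨ cong (_+_ (count (2 + n) k (λ f → (f a == f b) ∧ proper f))) (∑-==-*-monochromatic-non-adj a≢b ¬ab) ⟩
    count (2 + n) k (λ f → (f a == f b) ∧ proper f) + numEdges Γ * k ^ n ∎
    where open ≤-Reasoning

record IsSwap (g : Permutation′ n) (a b : Fin n) : Set where
  field
    distinct : a ≢ b
    a↦b      : g ⟨$⟩ʳ a ≡ b
    b↦a      : g ⟨$⟩ʳ b ≡ a
    fixes    : ∀ l → l ≡ a ⊎ l ≡ b ⊎ g ⟨$⟩ʳ l ≡ l

IsSwap-sym : ∀ {g : Permutation′ n} {a b} → IsSwap g a b → IsSwap g b a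
IsSwap-sym s = record
  { distinct = distinct ∘ sym ; a↦b = b↦a ; b↦a = a↦b
  ; fixes    = λ l → [ inj₂ ∘ inj₁ , [ inj₁ , inj₂ ∘ inj₂ ]′ ]′ (fixes l)
  }
  where open IsSwap s

isTranspOf⇒IsSwap : ∀ {g : Permutation′ n} {a b} → T (isTranspOf g a b) → IsSwap g a b
isTranspOf⇒IsSwap {g = g} {a} {b} t
  with a≢b , t₁ ← T-∧⁻ {not (a == b)} t
  with ga , t₂ ← T-∧⁻ {(g ⟨$⟩ʳ a) == b} t₁
  with gb , t₃ ← T-∧⁻ {(g ⟨$⟩ʳ b) == a} t₂ = record
  { distinct = T-not⇒¬T a≢b ∘ ≡⇒==
  ; a↦b      = ==⇒≡ ga
  ; b↦a      = ==⇒≡ gb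
  ; fixes    = λ l → Data.Sum.map ==⇒≡ (Data.Sum.map ==⇒≡ ==⇒≡ ∘ Equivalence.to T-∨)
                                   (Equivalence.to T-∨ (all-allFin⁻ _ t₃ l))
  }

IsSwap⇒isTranspOf : ∀ {g : Permutation′ n} {a b} → IsSwap g a b → T (isTranspOf g a b)
IsSwap⇒isTranspOf {a = a} {b} s =
  T-∧⁺ (¬T⇒T-not (distinct ∘ ==⇒≡ {i = a} {b}))
    (T-∧⁺ (≡⇒== a↦b) (T-∧⁺ (≡⇒== b↦a) (all-allFin⁺ _ λ l →
      Equivalence.from T-∨ (Data.Sum.map ≡⇒== (Equivalence.from T-∨ ∘ Data.Sum.map ≡⇒== ≡⇒==) (fixes l)))))
  where open IsSwap s

IsSwap-unique : ∀ {g : Permutation′ n} {a b i j} → IsSwap g a b → IsSwap g i j →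
  toℕ a < toℕ b → toℕ i < toℕ j → i ≡ a × j ≡ b
IsSwap-unique {i = i} sab sij a<b i<j with IsSwap.fixes sab i
... | inj₁ refl        = refl , trans (sym (IsSwap.a↦b sij)) (IsSwap.a↦b sab)
... | inj₂ (inj₁ refl) =
  ⊥-elim (<-asym a<b (subst (λ j → _ < toℕ j) (trans (sym (IsSwap.a↦b sij)) (IsSwap.b↦a sab)) i<j))
... | inj₂ (inj₂ fixed) = ⊥-elim (IsSwap.distinct sij (trans (sym fixed) (IsSwap.a↦b sij)))

NoSwap : Permutation′ n → Set
NoSwap g = ∀ a b → ¬ IsSwap g a b

module _ (Q : Fin n → Fin n → Bool) (g : Permutation′ n) where

  private
    swapsWith : Fin n → Fin n → Bool
    swapsWith i j = (toℕ i <ᵇ toℕ j) ∧ isTranspOf g i j ∧ Q i j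

  transpCount-NoSwap : NoSwap g → transpCount Q g ≡ 0
  transpCount-NoSwap none = trans (length-filterᵇ _ (allFin n)) (∑-zero (allFin n) λ i → ⟦⟧-false λ p →
    let j , q = any-allFin⁻ (swapsWith i) p in
    none i j (isTranspOf⇒IsSwap (proj₁ (T-∧⁻ (proj₂ (T-∧⁻ {toℕ i <ᵇ toℕ j} q))))))

  transpCount-IsSwap : ∀ {a b} → toℕ a < toℕ b → IsSwap g a b → transpCount Q g ≡ ⟦ Q a b ⟧
  transpCount-IsSwap {a} {b} a<b s = begin
    transpCount Q g                                 ≡⟨ length-filterᵇ _ (allFin n) ⟩
    ∑[ i ← allFin n ] ⟦ any (swapsWith i) (allFin n) ⟧ ≡⟨ ∑-cong (allFin n) (λ i → cong ⟦_⟧ (swapsWith-a i)) ⟩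
    ∑[ i ← allFin n ] ⟦ (i == a) ∧ Q a b ⟧          ≡⟨ ∑-cong (allFin n) (λ i → ⟦∧⟧ (i == a) (Q a b)) ⟩
    ∑[ i ← allFin n ] (⟦ i == a ⟧ * ⟦ Q a b ⟧)      ≡⟨ ∑-*ʳ (allFin n) _ ⟦ Q a b ⟧ ⟩
    ∑[ i ← allFin n ] ⟦ i == a ⟧ * ⟦ Q a b ⟧        ≡⟨ cong (_* ⟦ Q a b ⟧) (∑-allFin-== a) ⟩
    1 * ⟦ Q a b ⟧                                   ≡⟨ *-identityˡ _ ⟩
    ⟦ Q a b ⟧                                       ∎
    where
    open ≡-Reasoning
    swapsWith-a : ∀ i → any (swapsWith i) (allFin n) ≡ ((i == a) ∧ Q a b)
    swapsWith-a i = T-ext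
      (λ p → let j , q = any-allFin⁻ (swapsWith i) p
                 i<j , q′ = T-∧⁻ {toℕ i <ᵇ toℕ j} q
                 t , qij = T-∧⁻ {isTranspOf g i j} q′
                 i≡a , j≡b = IsSwap-unique s (isTranspOf⇒IsSwap t) a<b (<ᵇ⇒< _ _ i<j) in
             T-∧⁺ (≡⇒== i≡a) (subst₂ (λ x y → T (Q x y)) i≡a j≡b qij))
      (λ p → let i==a , qab = T-∧⁻ {i == a} p in
             case ==⇒≡ {i = i} i==a of λ where
               refl → any-allFin⁺ (swapsWith i) b (T-∧⁺ (<⇒<ᵇ a<b) (T-∧⁺ (IsSwap⇒isTranspOf s) qab)))

invariantᵇ-IsSwap : ∀ {g : Permutation′ n} {a b} → IsSwap g a b →
  (f : Colouring n k) → invariantᵇ g f ≡ (f a == f b)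
invariantᵇ-IsSwap {g = g} {a} {b} s f = T-ext
  (λ p → ≡⇒== (trans (sym (invariantᵇ⁻ g p a)) (cong f a↦b)))
  (λ p → invariantᵇ⁺ g λ l → case fixes l of λ where
    (inj₁ refl)        → trans (cong f a↦b) (sym (==⇒≡ p))
    (inj₂ (inj₁ refl)) → trans (cong f b↦a) (==⇒≡ p)
    (inj₂ (inj₂ gl≡l)) → cong f gl≡l)
  where open IsSwap s

cycles-IsSwap : ∀ {g : Permutation′ (suc m)} {a b} → IsSwap g a b → cycles g ≡ m
cycles-IsSwap {m} {g} {a} {b} s = cycles≡ {g = g} (begin
  count (suc m) 2 (invariantᵇ g)        ≡⟨ ∑-cong (allFuns (suc m) 2) (cong ⟦_⟧ ∘ invariantᵇ-IsSwap s) ⟩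
  count (suc m) 2 (λ f → f a == f b)  ≡⟨ count-== 2 (IsSwap.distinct s) ⟩
  2 ^ m                                 ∎)
  where open ≡-Reasoning

identity⇒NoSwap : ∀ {g : Permutation′ n} → g ≈ id → NoSwap g
identity⇒NoSwap is-id a b s = IsSwap.distinct s (trans (sym (is-id a)) (IsSwap.a↦b s))

identity-invariant : ∀ {g : Permutation′ n} → g ≈ id → (f : Colouring n k) → invariantᵇ g f ≡ true
identity-invariant {g = g} is-id f = T-ext (λ _ → _) (λ _ → invariantᵇ⁺ g (cong f ∘ is-id))

-- What a permutation other than the identity and the transpositions forces on invariant colourings.
record TwoConstraints (g : Permutation′ n) : Set where
  field
    a b c d  : Fin n
    a≢b      : a ≢ b
    c≢d      : c ≢ d
    c≢a      : c ≢ a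
    c≢b      : c ≢ b
    forced   : ∀ {k} (f : Colouring n k) → T (invariantᵇ g f) → f a ≡ f b × f c ≡ f d

data Shape (g : Permutation′ n) : Set where
  swap     : ∀ {a b} → toℕ a < toℕ b → IsSwap g a b → Shape g
  identity : g ≈ id → Shape g
  other    : NoSwap g → ¬ g ≈ id → TwoConstraints g → Shape g

IsSwap? : ∀ (g : Permutation′ n) a b → Dec (IsSwap g a b)
IsSwap? g a b = map′ isTranspOf⇒IsSwap IsSwap⇒isTranspOf (T? (isTranspOf g a b))

identity? : ∀ (g : Permutation′ n) → Dec (g ≈ id)
identity? g = all? (λ u → g ⟨$⟩ʳ u ≟ᶠ u)

twoConstraints : ∀ (g : Permutation′ n) → NoSwap g → ¬ g ≈ id → TwoConstraints g
twoConstraints {n} g none not-id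
  with a , ga≢a ← ¬∀⟶∃¬ n _ (λ u → g ⟨$⟩ʳ u ≟ᶠ u) not-id
  with g ⟨$⟩ʳ (g ⟨$⟩ʳ a) ≟ᶠ a
... | no gga≢a = record
  { a = a ; b = g ⟨$⟩ʳ a ; c = g ⟨$⟩ʳ (g ⟨$⟩ʳ a) ; d = g ⟨$⟩ʳ a
  ; a≢b = a≢ga ; c≢d = gga≢ga ; c≢a = gga≢a ; c≢b = gga≢ga
  ; forced = λ f inv → sym (invariantᵇ⁻ g inv a) , invariantᵇ⁻ g inv (g ⟨$⟩ʳ a)
  }
  where
  open Cycles g using (⟨$⟩ʳ-injective)
  a≢ga : a ≢ g ⟨$⟩ʳ a
  a≢ga = ga≢a ∘ sym
  gga≢ga : g ⟨$⟩ʳ (g ⟨$⟩ʳ a) ≢ g ⟨$⟩ʳ a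
  gga≢ga = ga≢a ∘ ⟨$⟩ʳ-injective
... | yes gga≡a with all? (λ l → l ≟ᶠ a ⊎-dec (l ≟ᶠ g ⟨$⟩ʳ a ⊎-dec (g ⟨$⟩ʳ l ≟ᶠ l)))
...   | yes fixes = ⊥-elim (none a (g ⟨$⟩ʳ a) record
  { distinct = ga≢a ∘ sym ; a↦b = refl ; b↦a = gga≡a ; fixes = fixes })
...   | no ¬fixes with l , l∉ ← ¬∀⟶∃¬ n _ (λ l → l ≟ᶠ a ⊎-dec (l ≟ᶠ g ⟨$⟩ʳ a ⊎-dec (g ⟨$⟩ʳ l ≟ᶠ l))) ¬fixes = record
  { a = a ; b = g ⟨$⟩ʳ a ; c = l ; d = g ⟨$⟩ʳ l
  ; a≢b = ga≢a ∘ sym ; c≢d = l∉ ∘ inj₂ ∘ inj₂ ∘ sym ; c≢a = l∉ ∘ inj₁ ; c≢b = l∉ ∘ inj₂ ∘ inj₁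
  ; forced = λ f inv → sym (invariantᵇ⁻ g inv a) , sym (invariantᵇ⁻ g inv l)
  }

classify : ∀ (g : Permutation′ n) → Shape g
classify g with any? (λ a → any? (λ b → IsSwap? g a b))
... | yes (a , b , s) with <-cmp (toℕ a) (toℕ b)
...   | tri< a<b _ _ = swap a<b s
...   | tri≈ _ a≡b _ = ⊥-elim (IsSwap.distinct s (toℕ-injective a≡b))
...   | tri> _ _ b<a = swap b<a (IsSwap-sym s)
classify g | no no-swap with identity? g
...   | yes is-id = identity is-id
...   | no not-id = other none not-id (twoConstraints g none not-id)
  where
  none : NoSwap g
  none a b s = no-swap (a , b , s)

*-<-self⇒0 : ∀ a {K} → a * K < K → a ≡ 0
*-<-self⇒0 zero    _  = refl
*-<-self⇒0 (suc a) {K} lt = ⊥-elim (<⇒≱ lt (m≤m+n K (a * K)))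

∣+x-+y∣≤ : ∀ {x y c} → x ≤ y + c → y ≤ x + c → ∣ + x -ℤ + y ∣ ≤ c
∣+x-+y∣≤ {x} {y} {c} x≤y+c y≤x+c with ≤-total y x
... | inj₁ y≤x = subst (_≤ c) (sym (trans (cong ∣_∣ (ℤ.m-n≡m⊖n x y)) (cong ∣_∣ (ℤ.⊖-≥ y≤x))))
                       (m≤n+o⇒m∸n≤o x y x≤y+c)
... | inj₂ x≤y = subst (_≤ c) (sym (trans (cong ∣_∣ (ℤ.m-n≡m⊖n x y)) (ℤ.∣⊖∣-≤ x≤y)))
                       (m≤n+o⇒m∸n≤o y x y≤x+c)

pos-^ : ∀ k c → (+ k) ^ℤ c ≡ + (k ^ c)
pos-^ k zero    = refl
pos-^ k (suc c) = trans (cong (+ k *ℤ_) (pos-^ k c)) (sym (ℤ.pos-* k (k ^ c)))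

∣^∣ : ∀ (x : ℤ) c → ∣ x ^ℤ c ∣ ≡ ∣ x ∣ ^ c
∣^∣ x zero    = refl
∣^∣ x (suc c) = trans (ℤ.∣i*j∣≡∣i∣*∣j∣ x (x ^ℤ c)) (cong (∣ x ∣ *_) (∣^∣ x c))

-1^c*[-x]^c : ∀ c (x : ℤ) → -1ℤ ^ℤ c *ℤ (- x) ^ℤ c ≡ x ^ℤ c
-1^c*[-x]^c zero    x = refl
-1^c*[-x]^c (suc c) x = trans (regroup (-1ℤ ^ℤ c) ((- x) ^ℤ c) x) (cong (x *ℤ_) (-1^c*[-x]^c c x))
  where
  regroup : ∀ a b x → (-1ℤ *ℤ a) *ℤ (- x *ℤ b) ≡ x *ℤ (a *ℤ b)
  regroup = ℤ-Solver.solve-∀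

-1^[1+c]*[-x]^c : ∀ c (x : ℤ) → -1ℤ ^ℤ suc c *ℤ (- x) ^ℤ c ≡ - (x ^ℤ c)
-1^[1+c]*[-x]^c c x = trans (regroup (-1ℤ ^ℤ c) ((- x) ^ℤ c)) (cong -_ (-1^c*[-x]^c c x))
  where
  regroup : ∀ a b → (-1ℤ *ℤ a) *ℤ b ≡ - (a *ℤ b)
  regroup = ℤ-Solver.solve-∀

∣-1^a*[-k]^c∣ : ∀ a k c → ∣ -1ℤ ^ℤ a *ℤ (- + k) ^ℤ c ∣ ≡ k ^ c
∣-1^a*[-k]^c∣ a k c = begin
  ∣ -1ℤ ^ℤ a *ℤ (- + k) ^ℤ c ∣        ≡⟨ ℤ.∣i*j∣≡∣i∣*∣j∣ (-1ℤ ^ℤ a) _ ⟩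
  ∣ -1ℤ ^ℤ a ∣ * ∣ (- + k) ^ℤ c ∣     ≡⟨ cong₂ _*_ (∣^∣ -1ℤ a) (∣^∣ (- + k) c) ⟩
  1 ^ a * ∣ - + k ∣ ^ c               ≡⟨ cong₂ (λ x y → x * y ^ c) (^-zeroˡ a) (ℤ.∣-i∣≡∣i∣ (+ k)) ⟩
  1 * k ^ c                           ≡⟨ *-identityˡ _ ⟩
  k ^ c                               ∎
  where open ≡-Reasoning

cycles-identity : ∀ {g : Permutation′ n} → g ≈ id → cycles g ≡ n
cycles-identity {n} {g} is-id =
  cycles≡ {g = g} (trans (∑-cong (allFuns n 2) (cong ⟦_⟧ ∘ identity-invariant is-id)) (count-true n 2))

sign-identity : ∀ {g : Permutation′ n} k → g ≈ id → -1ℤ ^ℤ n *ℤ (- + k) ^ℤ cycles g ≡ + k ^ n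
sign-identity {n} {g} k is-id = begin
  -1ℤ ^ℤ n *ℤ (- + k) ^ℤ cycles g ≡⟨ cong (λ c → -1ℤ ^ℤ n *ℤ (- + k) ^ℤ c) (cycles-identity {g = g} is-id) ⟩
  -1ℤ ^ℤ n *ℤ (- + k) ^ℤ n        ≡⟨ -1^c*[-x]^c n (+ k) ⟩
  (+ k) ^ℤ n                      ≡⟨ pos-^ k n ⟩
  + k ^ n                         ∎
  where open ≡-Reasoning

sign-IsSwap : ∀ {g : Permutation′ (suc m)} {a b} k → IsSwap g a b →
  -1ℤ ^ℤ suc m *ℤ (- + k) ^ℤ cycles g ≡ - + k ^ m
sign-IsSwap {m} {g} k s = begin
  -1ℤ ^ℤ suc m *ℤ (- + k) ^ℤ cycles g ≡⟨ cong (λ c → -1ℤ ^ℤ suc m *ℤ (- + k) ^ℤ c) (cycles-IsSwap s) ⟩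
  -1ℤ ^ℤ suc m *ℤ (- + k) ^ℤ m        ≡⟨ -1^[1+c]*[-x]^c m (+ k) ⟩
  - ((+ k) ^ℤ m)                      ≡⟨ cong -_ (pos-^ k m) ⟩
  - + k ^ m                           ∎
  where open ≡-Reasoning

coefficient : SimpleGraph n → Permutation′ n → ℤ
coefficient Γ g = + (transpCount (λ _ _ → true) g + transpCount (λ i j → not (adj Γ i j)) g)
                  -ℤ + (numEdges Γ * ⟦ does (identity? g) ⟧)

module _ (Γ : SimpleGraph n) where

  coefficient-NoSwap : ∀ {g} → NoSwap g → coefficient Γ g ≡ - + (numEdges Γ * ⟦ does (identity? g) ⟧)
  coefficient-NoSwap {g} none =
    trans (cong₂ (λ x y → + (x + y) -ℤ + (numEdges Γ * ⟦ does (identity? g) ⟧))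
                 (transpCount-NoSwap _ g none) (transpCount-NoSwap _ g none))
          (ℤ.+-identityˡ _)

  coefficient-identity : ∀ {g} → g ≈ id → coefficient Γ g ≡ - + numEdges Γ
  coefficient-identity {g} is-id = begin
    coefficient Γ g                                   ≡⟨ coefficient-NoSwap (identity⇒NoSwap {g = g} is-id) ⟩
    - + (numEdges Γ * ⟦ does (identity? g) ⟧)         ≡⟨ cong (λ x → - + (numEdges Γ * ⟦ x ⟧)) (dec-true (identity? g) is-id) ⟩
    - + (numEdges Γ * 1)                              ≡⟨ cong (λ x → - + x) (*-identityʳ (numEdges Γ)) ⟩
    - + numEdges Γ                                    ∎
    where open ≡-Reasoning

  coefficient-other : ∀ {g} → NoSwap g → ¬ g ≈ id → coefficient Γ g ≡ + 0
  coefficient-other {g} none not-id = begin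
    coefficient Γ g                                   ≡⟨ coefficient-NoSwap none ⟩
    - + (numEdges Γ * ⟦ does (identity? g) ⟧)         ≡⟨ cong (λ x → - + (numEdges Γ * ⟦ x ⟧)) (dec-false (identity? g) not-id) ⟩
    - + (numEdges Γ * 0)                              ≡⟨ cong (λ x → - + x) (*-zeroʳ (numEdges Γ)) ⟩
    + 0                                               ∎
    where open ≡-Reasoning

  coefficient-IsSwap : ∀ {g a b} → toℕ a < toℕ b → IsSwap g a b → coefficient Γ g ≡ + (1 + ⟦ not (adj Γ a b) ⟧)
  coefficient-IsSwap {g} {a} {b} a<b s = begin
    coefficient Γ g
      ≡⟨ cong₂ (λ x y → + (x + y) -ℤ + (numEdges Γ * ⟦ does (identity? g) ⟧))
               (transpCount-IsSwap _ g a<b s) (transpCount-IsSwap _ g a<b s) ⟩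
    + (1 + ⟦ not (adj Γ a b) ⟧) -ℤ + (numEdges Γ * ⟦ does (identity? g) ⟧)
      ≡⟨ cong (λ x → + (1 + ⟦ not (adj Γ a b) ⟧) -ℤ + (numEdges Γ * ⟦ x ⟧))
              (dec-false (identity? g) (λ is-id → identity⇒NoSwap is-id a b s)) ⟩
    + (1 + ⟦ not (adj Γ a b) ⟧) -ℤ + (numEdges Γ * 0)
      ≡⟨ cong (λ x → + (1 + ⟦ not (adj Γ a b) ⟧) -ℤ + x) (*-zeroʳ (numEdges Γ)) ⟩
    + (1 + ⟦ not (adj Γ a b) ⟧) -ℤ + 0
      ≡⟨ ℤ.+-identityʳ _ ⟩
    + (1 + ⟦ not (adj Γ a b) ⟧) ∎
    where open ≡-Reasoning

-- The term of g in P_{Γ,G}(k) - (-1)^N F_G(-k) is k ^ (N - 1) times `coefficient Γ g`,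
-- up to an error of order k ^ (N - 2).
module FirstOrder (Γ : SimpleGraph (2 + n)) (k : ℕ) where
  open ProperColourings Γ k

  deviation : Permutation′ (2 + n) → ℤ
  deviation g = + chromQuot Γ g k -ℤ -1ℤ ^ℤ (2 + n) *ℤ (- + k) ^ℤ cycles g

  errorBound : ℕ
  errorBound = (numEdges Γ * numEdges Γ + numEdges Γ + 2) * k ^ n

  error : Permutation′ (2 + n) → ℤ
  error g = deviation g -ℤ coefficient Γ g *ℤ + k ^ (1 + n)

  private
    K₁ K₀ : ℕ
    K₁ = k ^ (1 + n)
    K₀ = k ^ n

    errorBound-≥ : ∀ {x} → x ≤ numEdges Γ * numEdges Γ + numEdges Γ + 2 → x * K₀ ≤ errorBound
    errorBound-≥ x≤B = *-monoˡ-≤ K₀ x≤B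

  chromQuot-IsSwap : ∀ {g a b} → IsSwap g a b → chromQuot Γ g k ≡ count (2 + n) k (λ f → (f a == f b) ∧ proper f)
  chromQuot-IsSwap {g} s = trans (Quotient.chromQuot≡count Γ g k)
    (∑-cong Fs λ f → cong (λ x → ⟦ x ∧ proper f ⟧) (invariantᵇ-IsSwap s f))

  chromQuot-identity : ∀ {g} → g ≈ id → chromQuot Γ g k ≡ count (2 + n) k proper
  chromQuot-identity {g} is-id = trans (Quotient.chromQuot≡count Γ g k)
    (∑-cong Fs λ f → cong (λ x → ⟦ x ∧ proper f ⟧) (identity-invariant is-id f))

  chromQuot≤ : ∀ g → chromQuot Γ g k ≤ count (2 + n) k (invariantᵇ g)
  chromQuot≤ g = ≤-trans (≤-reflexive (Quotient.chromQuot≡count Γ g k))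
                         (∑-mono Fs λ f → ⟦⟧-mono (proj₁ ∘ T-∧⁻ {invariantᵇ g f}))

  error-swap : ∀ {g a b} → toℕ a < toℕ b → IsSwap g a b → ∣ error g ∣ ≤ errorBound
  error-swap {g} {a} {b} a<b s = subst (λ e → ∣ e ∣ ≤ errorBound) (sym error≡) (bound (adj Γ a b) refl)
    where
    C : ℕ
    C = count (2 + n) k (λ f → (f a == f b) ∧ proper f)
    error≡ : error g ≡ + C -ℤ + (⟦ not (adj Γ a b) ⟧ * K₁)
    error≡ = begin
      error g
        ≡⟨ cong₂ (λ x y → (+ x -ℤ y) -ℤ coefficient Γ g *ℤ + K₁) (chromQuot-IsSwap s) (sign-IsSwap k s) ⟩
      (+ C -ℤ - + K₁) -ℤ coefficient Γ g *ℤ + K₁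
        ≡⟨ cong (λ c → (+ C -ℤ - + K₁) -ℤ c *ℤ + K₁) (trans (coefficient-IsSwap Γ a<b s) (ℤ.pos-+ 1 _)) ⟩
      (+ C -ℤ - + K₁) -ℤ (+ 1 +ℤ + ⟦ not (adj Γ a b) ⟧) *ℤ + K₁
        ≡⟨ regroup (+ C) (+ K₁) (+ ⟦ not (adj Γ a b) ⟧) ⟩
      + C -ℤ + ⟦ not (adj Γ a b) ⟧ *ℤ + K₁
        ≡⟨ cong (λ x → + C -ℤ x) (ℤ.pos-* ⟦ not (adj Γ a b) ⟧ K₁) ⟨
      + C -ℤ + (⟦ not (adj Γ a b) ⟧ * K₁) ∎
      where
      open ≡-Reasoning
      regroup : ∀ c x t → (c -ℤ - x) -ℤ (+ 1 +ℤ t) *ℤ x ≡ c -ℤ t *ℤ x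
      regroup = ℤ-Solver.solve-∀
    bound : ∀ e → adj Γ a b ≡ e → ∣ + C -ℤ + (⟦ not e ⟧ * K₁) ∣ ≤ errorBound
    bound true  ab = ∣+x-+y∣≤ {y = 0} (≤-trans (≤-reflexive (count-merged-proper-adj (subst T (sym ab) _))) z≤n) z≤n
    bound false ab = ∣+x-+y∣≤
      (≤-trans (count-merged-proper-upper (IsSwap.distinct s))
               (≤-trans (≤-reflexive (sym (*-identityˡ K₁))) (m≤m+n (1 * K₁) _)))
      (≤-trans (≤-reflexive (*-identityˡ K₁))
        (≤-trans (count-merged-proper-lower (IsSwap.distinct s) (subst T ab))
                 (+-monoʳ-≤ C (errorBound-≥ (≤-trans (m≤n+m _ (numEdges Γ * numEdges Γ)) (m≤m+n _ 2))))))

  error-identity : ∀ {g} → g ≈ id → ∣ error g ∣ ≤ errorBound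
  error-identity {g} is-id = subst (λ e → ∣ e ∣ ≤ errorBound) (sym error≡)
    (∣+x-+y∣≤ (≤-trans count-proper-upper (+-monoʳ-≤ (k ^ (2 + n)) (errorBound-≥ m²≤B)))
              (≤-trans count-proper-lower (m≤m+n _ _)))
    where
    P : ℕ
    P = count (2 + n) k proper
    m²≤B : numEdges Γ * numEdges Γ ≤ numEdges Γ * numEdges Γ + numEdges Γ + 2
    m²≤B = ≤-trans (m≤m+n _ (numEdges Γ)) (m≤m+n _ 2)
    error≡ : error g ≡ + (P + numEdges Γ * K₁) -ℤ + k ^ (2 + n)
    error≡ = begin
      error g
        ≡⟨ cong₂ (λ x y → (+ x -ℤ y) -ℤ coefficient Γ g *ℤ + K₁) (chromQuot-identity is-id) (sign-identity k is-id) ⟩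
      (+ P -ℤ + k ^ (2 + n)) -ℤ coefficient Γ g *ℤ + K₁
        ≡⟨ cong (λ c → (+ P -ℤ + k ^ (2 + n)) -ℤ c *ℤ + K₁) (coefficient-identity Γ {g} is-id) ⟩
      (+ P -ℤ + k ^ (2 + n)) -ℤ (- + numEdges Γ) *ℤ + K₁
        ≡⟨ regroup (+ P) (+ k ^ (2 + n)) (+ numEdges Γ) (+ K₁) ⟩
      + P +ℤ + numEdges Γ *ℤ + K₁ -ℤ + k ^ (2 + n)
        ≡⟨ cong (λ x → + P +ℤ x -ℤ + k ^ (2 + n)) (ℤ.pos-* (numEdges Γ) K₁) ⟨
      + P +ℤ + (numEdges Γ * K₁) -ℤ + k ^ (2 + n)
        ≡⟨ cong (λ x → x -ℤ + k ^ (2 + n)) (ℤ.pos-+ P (numEdges Γ * K₁)) ⟨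
      + (P + numEdges Γ * K₁) -ℤ + k ^ (2 + n) ∎
      where
      open ≡-Reasoning
      regroup : ∀ p y e x → (p -ℤ y) -ℤ (- e) *ℤ x ≡ p +ℤ e *ℤ x -ℤ y
      regroup = ℤ-Solver.solve-∀

  error-other : ∀ {g} → NoSwap g → ¬ g ≈ id → TwoConstraints g → ∣ error g ∣ ≤ errorBound
  error-other {g} none not-id tc = begin
    ∣ error g ∣
      ≡⟨ cong ∣_∣ error≡ ⟩
    ∣ + chromQuot Γ g k -ℤ S ∣
      ≤⟨ ℤ.∣i-j∣≤∣i∣+∣j∣ (+ chromQuot Γ g k) S ⟩
    chromQuot Γ g k + ∣ S ∣
      ≡⟨ cong (_+_ (chromQuot Γ g k)) (trans (∣-1^a*[-k]^c∣ (2 + n) k (cycles g)) (Cycles.^cycles≡count g k)) ⟩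
    chromQuot Γ g k + count (2 + n) k (invariantᵇ g)
      ≤⟨ +-mono-≤ (≤-trans (chromQuot≤ g) invariant≤) invariant≤ ⟩
    K₀ + K₀
      ≡⟨ cong (_+_ K₀) (+-identityʳ K₀) ⟨
    2 * K₀
      ≤⟨ errorBound-≥ (m≤n+m 2 _) ⟩
    errorBound ∎
    where
    open ≤-Reasoning
    open TwoConstraints tc
    S : ℤ
    S = -1ℤ ^ℤ (2 + n) *ℤ (- + k) ^ℤ cycles g
    error≡ : error g ≡ + chromQuot Γ g k -ℤ S
    error≡ = trans (cong (λ c → (+ chromQuot Γ g k -ℤ S) -ℤ c *ℤ + K₁) (coefficient-other Γ none not-id))
                   (drop-zero (+ chromQuot Γ g k -ℤ S) (+ K₁))
      where
      drop-zero : ∀ x y → x -ℤ + 0 *ℤ y ≡ x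
      drop-zero = ℤ-Solver.solve-∀
    invariant≤ : count (2 + n) k (invariantᵇ g) ≤ K₀
    invariant≤ = ≤-trans (∑-mono Fs λ f → ⟦⟧-mono λ inv →
                           let fa≡fb , fc≡fd = forced f inv in T-∧⁺ (≡⇒== fa≡fb) (≡⇒== fc≡fd))
                         (≤-reflexive (count-==-== k a≢b c≢d c≢a c≢b))

  error≤ : ∀ g → ∣ error g ∣ ≤ errorBound
  error≤ g with classify g
  ... | swap a<b s            = error-swap a<b s
  ... | identity is-id        = error-identity is-id
  ... | other none not-id tc  = error-other none not-id tc

sumℤ-map-sub : ∀ (xs : List A) (x y : A → ℤ) →
  sumℤ (map (λ a → x a -ℤ y a) xs) ≡ sumℤ (map x xs) -ℤ sumℤ (map y xs)
sumℤ-map-sub []       x y = refl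
sumℤ-map-sub (a ∷ xs) x y = trans (cong (λ s → (x a -ℤ y a) +ℤ s) (sumℤ-map-sub xs x y))
                               (regroup (x a) (y a) (sumℤ (map x xs)) (sumℤ (map y xs)))
  where
  regroup : ∀ a b c d → (a -ℤ b) +ℤ (c -ℤ d) ≡ (a +ℤ c) -ℤ (b +ℤ d)
  regroup = ℤ-Solver.solve-∀

sumℤ-map-*ˡ : ∀ (xs : List A) c (y : A → ℤ) → sumℤ (map (λ a → c *ℤ y a) xs) ≡ c *ℤ sumℤ (map y xs)
sumℤ-map-*ˡ []       c y = sym (ℤ.*-zeroʳ c)
sumℤ-map-*ˡ (a ∷ xs) c y =
  trans (cong (λ s → c *ℤ y a +ℤ s) (sumℤ-map-*ˡ xs c y)) (sym (ℤ.*-distribˡ-+ c (y a) _))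

sumℤ-map-*ʳ : ∀ (xs : List A) (y : A → ℤ) c → sumℤ (map (λ a → y a *ℤ c) xs) ≡ sumℤ (map y xs) *ℤ c
sumℤ-map-*ʳ []       y c = refl
sumℤ-map-*ʳ (a ∷ xs) y c =
  trans (cong (λ s → y a *ℤ c +ℤ s) (sumℤ-map-*ʳ xs y c)) (sym (ℤ.*-distribʳ-+ c (y a) _))

sumℤ-map-pos : ∀ (xs : List A) (F : A → ℕ) → sumℤ (map (λ a → + F a) xs) ≡ + ∑ xs F
sumℤ-map-pos []       F = refl
sumℤ-map-pos (a ∷ xs) F = trans (cong (λ s → + F a +ℤ s) (sumℤ-map-pos xs F)) (sym (ℤ.pos-+ (F a) _))

∣sumℤ-map∣≤ : ∀ (xs : List A) (e : A → ℤ) {c} → (∀ a → ∣ e a ∣ ≤ c) → ∣ sumℤ (map e xs) ∣ ≤ length xs * c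
∣sumℤ-map∣≤ []       e bound = z≤n
∣sumℤ-map∣≤ (a ∷ xs) e bound =
  ≤-trans (ℤ.∣i+j∣≤∣i∣+∣j∣ (e a) _) (+-mono-≤ (bound a) (∣sumℤ-map∣≤ xs e bound))

≈id-unique : ∀ {g h : Permutation′ n} → g ≈ id → h ≈ id → g ≈ h
≈id-unique g≈id h≈id i = trans (g≈id i) (sym (h≈id i))

∑-identity : ∀ {G : List (Permutation′ n)} → AllPairs (λ g h → ¬ g ≈ h) G → id ∈ₚ G →
  ∑[ g ← G ] ⟦ does (identity? g) ⟧ ≡ 1
∑-identity {G = g ∷ G} (g≉ ∷ _) (here g≈id) =
  cong₂ _+_ (cong ⟦_⟧ (dec-true (identity? g) g≈id))
            (∑-zero-All G (All.map (λ {h} g≉h → cong ⟦_⟧ (dec-false (identity? h) (g≉h ∘ ≈id-unique {g = g} {h} g≈id))) g≉))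
∑-identity {G = g ∷ G} (g≉ ∷ distinct) (there id∈G) =
  cong₂ _+_ (cong ⟦_⟧ (dec-false (identity? g) λ g≈id → All.lookupWith (λ {h} g≉h → g≉h ∘ ≈id-unique {g = g} {h} g≈id) g≉ id∈G))
            (∑-identity distinct id∈G)

∑-coefficient : ∀ {Γ : SimpleGraph n} {G} → IsAutSubgroup Γ G →
  sumℤ (map (coefficient Γ) G) ≡ + (t G + t⁰ Γ G) -ℤ + numEdges Γ
∑-coefficient {Γ = Γ} {G} subgroup = begin
  sumℤ (map (coefficient Γ) G)
    ≡⟨ sumℤ-map-sub G (λ g → + (tc g + tc⁰ g)) (λ g → + (numEdges Γ * ⟦ does (identity? g) ⟧)) ⟩
  sumℤ (map (λ g → + (tc g + tc⁰ g)) G) -ℤ sumℤ (map (λ g → + (numEdges Γ * ⟦ does (identity? g) ⟧)) G)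
    ≡⟨ cong₂ _-ℤ_ (sumℤ-map-pos G _) (sumℤ-map-pos G _) ⟩
  + ∑[ g ← G ] (tc g + tc⁰ g) -ℤ + ∑[ g ← G ] (numEdges Γ * ⟦ does (identity? g) ⟧)
    ≡⟨ cong₂ (λ x y → + x -ℤ + y) (∑-+ G tc tc⁰) (∑-*ˡ G (numEdges Γ) _) ⟩
  + (∑ G tc + ∑ G tc⁰) -ℤ + (numEdges Γ * ∑[ g ← G ] ⟦ does (identity? g) ⟧)
    ≡⟨ cong₂ (λ x y → + x -ℤ + (numEdges Γ * y))
             (sym (cong₂ _+_ (foldr-+-map≡∑ G tc) (foldr-+-map≡∑ G tc⁰)))
             (∑-identity (IsAutSubgroup.distinct subgroup) (IsAutSubgroup.hasId subgroup)) ⟩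
  + (t G + t⁰ Γ G) -ℤ + (numEdges Γ * 1)
    ≡⟨ cong (λ x → + (t G + t⁰ Γ G) -ℤ + x) (*-identityʳ (numEdges Γ)) ⟩
  + (t G + t⁰ Γ G) -ℤ + numEdges Γ ∎
  where
  open ≡-Reasoning
  tc tc⁰ : Permutation′ _ → ℕ
  tc  = transpCount (λ _ _ → true)
  tc⁰ = transpCount (λ i j → not (adj Γ i j))

module _ (Γ : SimpleGraph (2 + n)) (G : List (Permutation′ (2 + n))) (reciprocal : Reciprocal Γ G) where

  module _ (k : ℕ) where
    open FirstOrder Γ k

    ∑-deviation : sumℤ (map deviation G) ≡ + 0
    ∑-deviation = begin
      sumℤ (map deviation G)
        ≡⟨ sumℤ-map-sub G (λ g → + chromQuot Γ g k) (λ g → -1ℤ ^ℤ (2 + n) *ℤ (- + k) ^ℤ cycles g) ⟩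
      orbChrom Γ G k -ℤ sumℤ (map (λ g → -1ℤ ^ℤ (2 + n) *ℤ (- + k) ^ℤ cycles g) G)
        ≡⟨ cong₂ _-ℤ_ (reciprocal k) (sumℤ-map-*ˡ G (-1ℤ ^ℤ (2 + n)) (λ g → (- + k) ^ℤ cycles g)) ⟩
      -1ℤ ^ℤ (2 + n) *ℤ cycPoly G (- + k) -ℤ -1ℤ ^ℤ (2 + n) *ℤ cycPoly G (- + k)
        ≡⟨ ℤ.+-inverseʳ (-1ℤ ^ℤ (2 + n) *ℤ cycPoly G (- + k)) ⟩
      + 0 ∎
      where open ≡-Reasoning

    ∣∑coefficient∣*k^[1+n]≤ : ∣ sumℤ (map (coefficient Γ) G) ∣ * k ^ (1 + n) ≤ length G * errorBound
    ∣∑coefficient∣*k^[1+n]≤ = begin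
      ∣ Σc ∣ * k ^ (1 + n)                         ≡⟨ ℤ.∣i*j∣≡∣i∣*∣j∣ Σc (+ k ^ (1 + n)) ⟨
      ∣ Σc *ℤ + k ^ (1 + n) ∣                      ≡⟨ ℤ.∣-i∣≡∣i∣ (Σc *ℤ + k ^ (1 + n)) ⟨
      ∣ - (Σc *ℤ + k ^ (1 + n)) ∣                  ≡⟨ cong ∣_∣ ∑-error ⟨
      ∣ sumℤ (map error G) ∣                       ≤⟨ ∣sumℤ-map∣≤ G error error≤ ⟩
      length G * errorBound                        ∎
      where
      open ≤-Reasoning
      Σc : ℤ
      Σc = sumℤ (map (coefficient Γ) G)
      ∑-error : sumℤ (map error G) ≡ - (Σc *ℤ + k ^ (1 + n))
      ∑-error = trans (sumℤ-map-sub G deviation (λ g → coefficient Γ g *ℤ + k ^ (1 + n)))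
                      (trans (cong₂ _-ℤ_ ∑-deviation (sumℤ-map-*ʳ G (coefficient Γ) (+ k ^ (1 + n))))
                             (ℤ.+-identityˡ _))

  -- Taking k larger than length G times the error constant forces the sum of coefficients to vanish.
  ∑-coefficient≡0 : sumℤ (map (coefficient Γ) G) ≡ + 0
  ∑-coefficient≡0 = ℤ.∣i∣≡0⇒i≡0 (*-<-self⇒0 _ (begin-strict
    ∣ Σc ∣ * (k₀ * k₀ ^ n)   ≤⟨ ∣∑coefficient∣*k^[1+n]≤ k₀ ⟩
    length G * (C * k₀ ^ n)  ≡⟨ *-assoc (length G) C (k₀ ^ n) ⟨
    length G * C * k₀ ^ n    <⟨ *-monoˡ-< (k₀ ^ n) {{m^n≢0 k₀ n}} (n<1+n (length G * C)) ⟩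
    k₀ * k₀ ^ n              ∎))
    where
    open ≤-Reasoning
    Σc : ℤ
    Σc = sumℤ (map (coefficient Γ) G)
    C k₀ : ℕ
    C = numEdges Γ * numEdges Γ + numEdges Γ + 2
    k₀ = suc (length G * C)

no-transpositions : ∀ (Γ : SimpleGraph n) (G : List (Permutation′ n)) → (∀ g → NoSwap g) → t G + t⁰ Γ G ≡ 0
no-transpositions Γ G none = cong₂ _+_ (vanishes (λ _ _ → true)) (vanishes (λ i j → not (adj Γ i j)))
  where
  vanishes : ∀ Q → foldr _+_ 0 (map (transpCount Q) G) ≡ 0
  vanishes Q = trans (foldr-+-map≡∑ G (transpCount Q)) (∑-zero G λ g → transpCount-NoSwap Q g (none g))

mainTheorem15 : ∀ (n : ℕ) (Γ : SimpleGraph n) (G : List (Permutation′ n)) →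
    IsAutSubgroup Γ G → Reciprocal Γ G → numEdges Γ ≡ t G + t⁰ Γ G
mainTheorem15 0 Γ G _ _ = sym (no-transpositions Γ G λ _ ())
mainTheorem15 1 Γ G _ _ = sym (no-transpositions Γ G λ { _ zero zero s → IsSwap.distinct s refl })
mainTheorem15 (suc (suc n)) Γ G subgroup reciprocal =
  sym (ℤ.+-injective (ℤ.i-j≡0⇒i≡j _ _ (trans (sym (∑-coefficient subgroup)) (∑-coefficient≡0 Γ G reciprocal))))
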